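{- Let $A\in\mathsf{ASM}(n)$ and $i\in[n-1]$. Then $i$ is a descent of $A$ if and only if there exists $w\in\mathrm{Perm}(A)$ such that $i$ is a descent of $w$ (i.e., $w(i)>w(i+1)$).
   Context: An $n\times n$ alternating sign matrix (ASM) is a matrix with entries in $\{ -1,0,1\}$ whose nonzero entries in each row and each column alternate in sign and sum to $1$; $\mathsf{ASM}(n)$ is the set of these. A permutation $w\in S_n$ is identified with the matrix having $1$'s at $(i,w(i))$. The corner sum function is $\mathrm{rk}_A(i,j)=\sum_{a\le i,\,b\le j}A_{a,b}$. Strong order: $A\le B$ iff $\mathrm{rk}_A\ge\mathrm{rk}_B$ entrywise. $\mathrm{Perm}(A)$ is the set of minimal elements in strong order of $\{w\in S_n:w\ge A\}$. For $i\in[n-1]$, $\pi_i(A)$ is the strong-order minimum of $\{B\in\mathsf{ASM}(n):\mathrm{rk}_B(a,b)=\mathrm{rk}_A(a,b)\text{ for all }a\neq i\}$, and $A$ has a descent at $i$ if $\pi_i(A)\neq A$. -}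

module Defs where

open import Data.Nat using (ℕ; zero; suc; _<_)
open import Data.Fin using (Fin; zero; suc; toℕ; fromℕ<; _≤?_)
import Data.Fin as F
open import Data.Fin.Permutation using (Permutation′; _⟨$⟩ʳ_)
open import Data.Integer using (ℤ; 0ℤ; 1ℤ; -1ℤ; -_; _+_; _≥_)
import Data.Integer as ℤ
open import Data.List using (List; []; _∷_; filter; foldr)
import Data.List as L
open import Data.Product using (Σ; _×_; ∃)
open import Data.Sum using (_⊎_)
open import Data.Bool using (if_then_else_; _∧_)
open import Relation.Nullary using (¬_; ¬?)
open import Relation.Nullary.Decidable using (⌊_⌋)
open import Relation.Binary.PropositionalEquality using (_≡_; _≢_)

-- n × n integer matrices; indices are 0-based (row a here = row a+1 in the paper)
Mat : ℕ → Set
Mat n = Fin n → Fin n → ℤ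

ΣFin : ∀ n → (Fin n → ℤ) → ℤ
ΣFin zero    f = 0ℤ
ΣFin (suc n) f = f zero + ΣFin n (λ k → f (suc k))

Alternating : List ℤ → Set
Alternating []            = Data.Unit.⊤ where import Data.Unit
Alternating (x ∷ [])      = Data.Unit.⊤ where import Data.Unit
Alternating (x ∷ y ∷ xs)  = (y ≡ - x) × Alternating (y ∷ xs)

nonzeros : List ℤ → List ℤ
nonzeros = filter (λ x → ¬? (x ℤ.≟ 0ℤ))

row : ∀ {n} → Mat n → Fin n → List ℤ
row {n} A a = L.tabulate (λ b → A a b)

col : ∀ {n} → Mat n → Fin n → List ℤ
col {n} A b = L.tabulate (λ a → A a b)

GoodLine : List ℤ → Set
GoodLine xs = Alternating (nonzeros xs) × foldr _+_ 0ℤ (nonzeros xs) ≡ 1ℤ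

IsASM : ∀ n → Mat n → Set
IsASM n A =
  (∀ a b → (A a b ≡ -1ℤ) ⊎ (A a b ≡ 0ℤ) ⊎ (A a b ≡ 1ℤ)) ×
  (∀ a → GoodLine (row A a)) ×
  (∀ b → GoodLine (col A b))

rk : ∀ {n} → Mat n → Fin n → Fin n → ℤ
rk {n} A a b = ΣFin n (λ a' → ΣFin n (λ b' →
  if ⌊ a' ≤? a ⌋ ∧ ⌊ b' ≤? b ⌋ then A a' b' else 0ℤ))

_≤ₛ_ : ∀ {n} → Mat n → Mat n → Set
_≤ₛ_ {n} A B = ∀ a b → rk A a b ≥ rk B a b

_≡ₘ_ : ∀ {n} → Mat n → Mat n → Set
_≡ₘ_ {n} A B = ∀ a b → A a b ≡ B a b

permMat : ∀ {n} → Permutation′ n → Mat n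
permMat w a b = if ⌊ (w ⟨$⟩ʳ a) F.≟ b ⌋ then 1ℤ else 0ℤ

InPerm : ∀ {n} → Mat n → Permutation′ n → Set
InPerm {n} A w =
  (A ≤ₛ permMat w) ×
  (∀ (u : Permutation′ n) → A ≤ₛ permMat u → permMat u ≤ₛ permMat w →
     permMat u ≡ₘ permMat w)

SameRkOff : ∀ {n} → Mat n → Fin n → Mat n → Set
SameRkOff {n} A i B = IsASM n B × (∀ a b → a ≢ i → rk B a b ≡ rk A a b)

IsPi : ∀ {n} → Mat n → Fin n → Mat n → Set
IsPi {n} A i P = SameRkOff A i P × (∀ B → SameRkOff A i B → P ≤ₛ B)

ASMDescent : ∀ {n} → Mat n → Fin n → Set
ASMDescent {n} A i = ∃ λ P → IsPi A i P × ¬ (P ≡ₘ A)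

-- w has a descent at i (0-based; next index given by i+1 < n): w(i) > w(i+1)
PermDescent : ∀ {n} → Permutation′ n → (i : Fin n) → suc (toℕ i) < n → Set
PermDescent w i h = (w ⟨$⟩ʳ fromℕ< h) F.< (w ⟨$⟩ʳ i)

-- An ASM is determined by its corner-sum function s on {0, …, n}², and the functions that arise are
-- exactly those vanishing on row and column 0, equal to the identity on row and column n, and
-- increasing by 0 or 1 at each step right or down.  In these terms π_i(A) raises row i of s to
-- min(s_{i-1} + 1, s_{i+1}), the largest value the step conditions allow, so i is a descent of A
-- iff some column c has s_i(c) = s_{i-1}(c) and s_{i+1}(c) = s_i(c) + 1.
--
-- Given such a column, a greedy permutation lies above A and has corner sums s on column c; every
-- w ∈ Perm(A) below it keeps those corner sums, which forces w(i+1) < c ≤ w(i).  Conversely, if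
-- w ∈ Perm(A) has w(i) > w(i+1), swapping rows i and i+1 of w gives a strictly smaller permutation,
-- and when π_i(A) = A it still lies above A, contradicting the minimality of w.

module Submission where

open import Defs
open import Data.Bool using (Bool; true; false; if_then_else_; _∧_)
open import Data.Empty using (⊥-elim)
open import Data.Fin as F using (Fin; zero; suc; toℕ; fromℕ<)
import Data.Fin.Properties as FP
open import Data.Fin.Permutation using (Permutation′; _⟨$⟩ʳ_; _⟨$⟩ˡ_; permutation; inverseˡ; transpose; _∘ₚ_)
import Data.Fin.Permutation.Components as PC
open import Data.Integer as ℤ using (ℤ; +_; 0ℤ; 1ℤ; -1ℤ; _-_; ∣_∣)
import Data.Integer.Properties as ℤP
import Algebra.Properties.CommutativeSemigroup ℤP.+-commutativeSemigroup as ℤ+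
open import Data.List as L using (List; []; _∷_; foldr)
open import Data.List.Relation.Unary.All using (All; []; _∷_)
open import Data.Nat as ℕ using (ℕ; zero; suc; z≤n; s≤s; _≤_; _<_; _∸_; _⊓_)
import Data.Nat.Properties as ℕP
import Algebra.Properties.CommutativeSemigroup ℕP.+-commutativeSemigroup as ℕ+
open import Data.Product using (Σ; _×_; _,_; proj₁; proj₂)
open import Data.Sum using (_⊎_; inj₁; inj₂)
open import Data.Unit using (tt)
import Data.Vec.Functional as V
open import Function using (_∘_)
open import Function.Bundles using (_⇔_; mk⇔)
open import Function.Definitions using (Injective)
open import Relation.Binary using (tri<; tri≈; tri>)
open import Relation.Binary.PropositionalEquality hiding (J)
open import Relation.Nullary using (Dec; yes; no; does; ¬_)
open import Relation.Nullary.Decidable using (⌊_⌋; dec-true; dec-false; isYes≗does; _×-dec_; _→-dec_; ¬?; map′)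

extend : ∀ {a} {A : Set a} {n} → A → (Fin n → A) → ℕ → A
extend {n = zero}  d f x       = d
extend {n = suc n} d f zero    = f zero
extend {n = suc n} d f (suc x) = extend d (f ∘ suc) x

module _ {a} {A : Set a} (d : A) where

  extend-toℕ : ∀ {n} (f : Fin n → A) a → extend d f (toℕ a) ≡ f a
  extend-toℕ f zero    = refl
  extend-toℕ f (suc a) = extend-toℕ (f ∘ suc) a

  extend-fromℕ< : ∀ {n} (f : Fin n → A) {x} (x<n : x ℕ.< n) → extend d f x ≡ f (fromℕ< x<n)
  extend-fromℕ< f {x} x<n = trans (cong (extend d f) (sym (FP.toℕ-fromℕ< x<n))) (extend-toℕ f (fromℕ< x<n))

  extend-≥ : ∀ {n} (f : Fin n → A) {x} → n ℕ.≤ x → extend d f x ≡ d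
  extend-≥ {zero}  f         _       = refl
  extend-≥ {suc n} f {suc x} (s≤s p) = extend-≥ (f ∘ suc) p

  extend-cong : ∀ {n} {f g : Fin n → A} → (∀ a → f a ≡ g a) → ∀ x → extend d f x ≡ extend d g x
  extend-cong {zero}  e x       = refl
  extend-cong {suc n} e zero    = e zero
  extend-cong {suc n} e (suc x) = extend-cong (e ∘ suc) x

  extend-cong-at : ∀ {n} {f g : Fin n → A} x → (∀ a → toℕ a ≡ x → f a ≡ g a) → extend d f x ≡ extend d g x
  extend-cong-at {zero}  x       e = refl
  extend-cong-at {suc n} zero    e = e zero refl
  extend-cong-at {suc n} (suc x) e = extend-cong-at x (λ a p → e (suc a) (cong suc p))

  extend-const : ∀ n x → extend {n = n} d (λ _ → d) x ≡ d
  extend-const zero    x       = refl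
  extend-const (suc n) zero    = refl
  extend-const (suc n) (suc x) = extend-const n x

  extend-if : ∀ {n} (c : ℕ → Bool) (g : Fin n → A) x →
    extend d (λ k → if c (toℕ k) then g k else d) x ≡ (if c x then extend d g x else d)
  extend-if {zero}  c g x with c x
  ... | true  = refl
  ... | false = refl
  extend-if {suc n} c g zero with c 0
  ... | true  = refl
  ... | false = refl
  extend-if {suc n} c g (suc x) = extend-if (c ∘ suc) (g ∘ suc) x

module Sums where

  open import Data.Integer using (_+_)
  open import Data.Integer.Tactic.RingSolver using (solve-∀)

  x+y-x≡y : ∀ x y → x + y - x ≡ y
  x+y-x≡y = solve-∀

  +-cancelˡ : ∀ a {x y} → a + x ≡ a + y → x ≡ y
  +-cancelˡ a {x} {y} e = trans (sym (x+y-x≡y a x)) (trans (cong (_- a) e) (x+y-x≡y a y))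

  sumTo : ℕ → (ℕ → ℤ) → ℤ
  sumTo zero    f = 0ℤ
  sumTo (suc m) f = sumTo m f + f m

  sumTo-cong : ∀ m {f g : ℕ → ℤ} → (∀ x → x ℕ.< m → f x ≡ g x) → sumTo m f ≡ sumTo m g
  sumTo-cong zero    e = refl
  sumTo-cong (suc m) e = cong₂ _+_ (sumTo-cong m (λ x p → e x (ℕP.m≤n⇒m≤1+n p))) (e m ℕP.≤-refl)

  sumTo-const0 : ∀ m → sumTo m (λ _ → 0ℤ) ≡ 0ℤ
  sumTo-const0 zero    = refl
  sumTo-const0 (suc m) = trans (ℤP.+-identityʳ _) (sumTo-const0 m)

  sumTo-zero : ∀ m {f : ℕ → ℤ} → (∀ x → x ℕ.< m → f x ≡ 0ℤ) → sumTo m f ≡ 0ℤ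
  sumTo-zero m e = trans (sumTo-cong m e) (sumTo-const0 m)

  sumTo-const1 : ∀ m → sumTo m (λ _ → 1ℤ) ≡ + m
  sumTo-const1 zero    = refl
  sumTo-const1 (suc m) = trans (cong (_+ 1ℤ) (sumTo-const1 m)) (trans (ℤP.+-comm (+ m) 1ℤ) (sym (ℤP.pos-+ 1 m)))

  sumTo-+ : ∀ m (f g : ℕ → ℤ) → sumTo m (λ x → f x + g x) ≡ sumTo m f + sumTo m g
  sumTo-+ zero    f g = refl
  sumTo-+ (suc m) f g rewrite sumTo-+ m f g = ℤ+.interchange (sumTo m f) (sumTo m g) (f m) (g m)

  sumTo-suc : ∀ m (f : ℕ → ℤ) → sumTo (suc m) f ≡ f 0 + sumTo m (f ∘ suc)
  sumTo-suc zero    f = trans (ℤP.+-identityˡ (f 0)) (sym (ℤP.+-identityʳ (f 0)))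
  sumTo-suc (suc m) f rewrite sumTo-suc m f = ℤP.+-assoc (f 0) (sumTo m (f ∘ suc)) (f (suc m))

  sumTo-telescope : ∀ m (h : ℕ → ℤ) → sumTo m (λ x → h (suc x) - h x) ≡ h m - h 0
  sumTo-telescope zero    h = sym (ℤP.+-inverseʳ (h 0))
  sumTo-telescope (suc m) h rewrite sumTo-telescope m h = chain (h m) (h 0) (h (suc m))
    where
    chain : ∀ a b c → a - b + (c - a) ≡ c - b
    chain = solve-∀

  ΣFin-cong : ∀ n {f g : Fin n → ℤ} → (∀ a → f a ≡ g a) → ΣFin n f ≡ ΣFin n g
  ΣFin-cong zero    e = refl
  ΣFin-cong (suc n) e = cong₂ _+_ (e zero) (ΣFin-cong n (e ∘ suc))

  ΣFin-const0 : ∀ n → ΣFin n (λ _ → 0ℤ) ≡ 0ℤ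
  ΣFin-const0 zero    = refl
  ΣFin-const0 (suc n) = trans (ℤP.+-identityˡ _) (ΣFin-const0 n)

  ΣFin≡sumTo : ∀ n (g : Fin n → ℤ) → ΣFin n g ≡ sumTo n (extend 0ℤ g)
  ΣFin≡sumTo zero    g = refl
  ΣFin≡sumTo (suc n) g = trans (cong (_+_ (g zero)) (ΣFin≡sumTo n (g ∘ suc))) (sym (sumTo-suc n (extend 0ℤ g)))

  cutAt : ℕ → (ℕ → ℤ) → ℕ → ℤ
  cutAt t f x = if does (x ℕ.≤? t) then f x else 0ℤ

  sumTo-cutAt-≤ : ∀ m t f → m ℕ.≤ suc t → sumTo m (cutAt t f) ≡ sumTo m f
  sumTo-cutAt-≤ zero    t f p       = refl
  sumTo-cutAt-≤ (suc m) t f (s≤s p) rewrite dec-true (m ℕ.≤? t) p =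
    cong (_+ f m) (sumTo-cutAt-≤ m t f (ℕP.m≤n⇒m≤1+n p))

  sumTo-cutAt : ∀ m t f → t ℕ.< m → sumTo m (cutAt t f) ≡ sumTo (suc t) f
  sumTo-cutAt (suc m) t f (s≤s t≤m) with ℕP.m≤n⇒m<n∨m≡n t≤m
  ... | inj₂ refl = sumTo-cutAt-≤ (suc m) m f ℕP.≤-refl
  ... | inj₁ t<m rewrite dec-false (m ℕ.≤? t) (ℕP.<⇒≱ t<m) =
    trans (ℤP.+-identityʳ _) (sumTo-cutAt m t f t<m)

  ΣFin-cutAt : ∀ n (v : Fin n → ℤ) b →
    ΣFin n (λ b′ → if ⌊ b′ F.≤? b ⌋ then v b′ else 0ℤ) ≡ sumTo (suc (toℕ b)) (extend 0ℤ v)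
  ΣFin-cutAt n v b = begin
      ΣFin n (λ b′ → if ⌊ b′ F.≤? b ⌋ then v b′ else 0ℤ)
    ≡⟨ ΣFin-cong n (λ b′ → cong (λ c → if c then v b′ else 0ℤ) (isYes≗does (b′ F.≤? b))) ⟩
      ΣFin n (λ b′ → if does (toℕ b′ ℕ.≤? toℕ b) then v b′ else 0ℤ)
    ≡⟨ ΣFin≡sumTo n _ ⟩
      sumTo n (extend 0ℤ (λ b′ → if does (toℕ b′ ℕ.≤? toℕ b) then v b′ else 0ℤ))
    ≡⟨ sumTo-cong n (λ x _ → extend-if 0ℤ (λ x → does (x ℕ.≤? toℕ b)) v x) ⟩
      sumTo n (cutAt (toℕ b) (extend 0ℤ v))
    ≡⟨ sumTo-cutAt n (toℕ b) (extend 0ℤ v) (FP.toℕ<n b) ⟩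
      sumTo (suc (toℕ b)) (extend 0ℤ v) ∎
    where open ≡-Reasoning

  extend-sumTo : ∀ {n} m (h : Fin n → ℕ → ℤ) x →
    extend 0ℤ (λ a → sumTo m (h a)) x ≡ sumTo m (λ y → extend 0ℤ (λ a → h a y) x)
  extend-sumTo {zero}  m h x       = sym (sumTo-const0 m)
  extend-sumTo {suc n} m h zero    = refl
  extend-sumTo {suc n} m h (suc x) = extend-sumTo m (h ∘ suc) x

open Sums

module CornerSums where

  open import Data.Integer using (_+_)

  entry : ∀ {n} → Mat n → ℕ → ℕ → ℤ
  entry A x y = extend 0ℤ (λ a → extend 0ℤ (A a) y) x

  corner : ∀ {n} → Mat n → ℕ → ℕ → ℤ
  corner A x y = sumTo x (λ a → sumTo y (entry A a))

  rowPrefix : ∀ {n} → Mat n → ℕ → ℕ → ℤ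
  rowPrefix A x y = sumTo y (entry A x)

  colPrefix : ∀ {n} → Mat n → ℕ → ℕ → ℤ
  colPrefix A x y = sumTo x (λ a → entry A a y)

  corner-sucʳ : ∀ {n} (A : Mat n) x y → corner A x (suc y) ≡ corner A x y + colPrefix A x y
  corner-sucʳ A x y = sumTo-+ x (λ a → sumTo y (entry A a)) (λ a → entry A a y)

  entry-toℕ : ∀ {n} (A : Mat n) a b → entry A (toℕ a) (toℕ b) ≡ A a b
  entry-toℕ A a b = trans (extend-toℕ 0ℤ (λ a → extend 0ℤ (A a) (toℕ b)) a) (extend-toℕ 0ℤ (A a) b)

  rowPrefix-toℕ : ∀ {n} (A : Mat n) a y → rowPrefix A (toℕ a) y ≡ sumTo y (extend 0ℤ (A a))
  rowPrefix-toℕ A a y = sumTo-cong y (λ b _ → extend-toℕ 0ℤ (λ a′ → extend 0ℤ (A a′) b) a)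

  colPrefix-toℕ : ∀ {n} (A : Mat n) x b → colPrefix A x (toℕ b) ≡ sumTo x (extend 0ℤ (λ a → A a b))
  colPrefix-toℕ A x b = sumTo-cong x (λ a _ → extend-cong 0ℤ (λ a′ → extend-toℕ 0ℤ (A a′) b) a)

  rk≡corner : ∀ {n} (A : Mat n) a b → rk A a b ≡ corner A (suc (toℕ a)) (suc (toℕ b))
  rk≡corner {n} A a b = begin
      rk A a b
    ≡⟨ ΣFin-cong n (λ a′ → trans (ΣFin-cong n (λ b′ → if-∧ ⌊ a′ F.≤? a ⌋ ⌊ b′ F.≤? b ⌋ (A a′ b′)))
                                  (ΣFin-if ⌊ a′ F.≤? a ⌋ (λ b′ → if ⌊ b′ F.≤? b ⌋ then A a′ b′ else 0ℤ))) ⟩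
      ΣFin n (λ a′ → if ⌊ a′ F.≤? a ⌋ then ΣFin n (λ b′ → if ⌊ b′ F.≤? b ⌋ then A a′ b′ else 0ℤ) else 0ℤ)
    ≡⟨ ΣFin-cong n (λ a′ → cong (λ z → if ⌊ a′ F.≤? a ⌋ then z else 0ℤ) (ΣFin-cutAt n (A a′) b)) ⟩
      ΣFin n (λ a′ → if ⌊ a′ F.≤? a ⌋ then sumTo (suc (toℕ b)) (extend 0ℤ (A a′)) else 0ℤ)
    ≡⟨ ΣFin-cutAt n (λ a′ → sumTo (suc (toℕ b)) (extend 0ℤ (A a′))) a ⟩
      sumTo (suc (toℕ a)) (extend 0ℤ (λ a′ → sumTo (suc (toℕ b)) (extend 0ℤ (A a′))))
    ≡⟨ sumTo-cong (suc (toℕ a)) (λ x _ → extend-sumTo (suc (toℕ b)) (λ a′ → extend 0ℤ (A a′)) x) ⟩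
      corner A (suc (toℕ a)) (suc (toℕ b)) ∎
    where
    open ≡-Reasoning
    if-∧ : ∀ c d (v : ℤ) → (if c ∧ d then v else 0ℤ) ≡ (if c then (if d then v else 0ℤ) else 0ℤ)
    if-∧ true  d v = refl
    if-∧ false d v = refl
    ΣFin-if : ∀ c (g : Fin n → ℤ) → ΣFin n (λ k → if c then g k else 0ℤ) ≡ (if c then ΣFin n g else 0ℤ)
    ΣFin-if true  g = refl
    ΣFin-if false g = ΣFin-const0 n

  corner-cong : ∀ {n} {A B : Mat n} → A ≡ₘ B → ∀ x y → corner A x y ≡ corner B x y
  corner-cong e x y = sumTo-cong x (λ a _ → sumTo-cong y (λ b _ →
    extend-cong 0ℤ (λ a′ → extend-cong 0ℤ (e a′) b) a))

  entry≡corner-diff : ∀ {n} (A : Mat n) x y →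
    entry A x y ≡ (corner A (suc x) (suc y) - corner A x (suc y)) - (corner A (suc x) y - corner A x y)
  entry≡corner-diff A x y = sym (trans
    (cong₂ _-_ (x+y-x≡y (corner A x (suc y)) (rowPrefix A x (suc y))) (x+y-x≡y (corner A x y) (rowPrefix A x y)))
    (x+y-x≡y (rowPrefix A x y) (entry A x y)))

  corner-injective : ∀ {n} {A B : Mat n} →
    (∀ x y → x ℕ.≤ n → y ℕ.≤ n → corner A x y ≡ corner B x y) → A ≡ₘ B
  corner-injective {n} {A} {B} e a b = begin
      A a b                    ≡⟨ sym (entry-toℕ A a b) ⟩
      entry A (toℕ a) (toℕ b)  ≡⟨ entry≡corner-diff A (toℕ a) (toℕ b) ⟩
      _                        ≡⟨ cong₂ _-_ (cong₂ _-_ (e _ _ a< b<) (e _ _ a≤ b<)) (cong₂ _-_ (e _ _ a< b≤) (e _ _ a≤ b≤)) ⟩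
      _                        ≡⟨ sym (entry≡corner-diff B (toℕ a) (toℕ b)) ⟩
      entry B (toℕ a) (toℕ b)  ≡⟨ entry-toℕ B a b ⟩
      B a b                    ∎
    where
    open ≡-Reasoning
    a< : suc (toℕ a) ℕ.≤ n
    a< = FP.toℕ<n a
    b< : suc (toℕ b) ℕ.≤ n
    b< = FP.toℕ<n b
    a≤ : toℕ a ℕ.≤ n
    a≤ = ℕP.<⇒≤ a<
    b≤ : toℕ b ℕ.≤ n
    b≤ = ℕP.<⇒≤ b<

open CornerSums

module Lines where

  open import Data.Integer using (_+_)

  Bit : ℤ → Set
  Bit z = z ≡ 0ℤ ⊎ z ≡ 1ℤ

  Trit : ℤ → Set
  Trit z = z ≡ -1ℤ ⊎ z ≡ 0ℤ ⊎ z ≡ 1ℤ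

  Sign : ℤ → Set
  Sign z = z ≡ 1ℤ ⊎ z ≡ -1ℤ

  BitWalk : ℤ → List ℤ → Set
  BitWalk s []       = s ≡ 1ℤ
  BitWalk s (x ∷ xs) = Bit (s + x) × BitWalk (s + x) xs

  data Zigzag : ℤ → List ℤ → Set where
    done : Zigzag 1ℤ []
    up   : ∀ {L} → Zigzag 1ℤ L → Zigzag 0ℤ (1ℤ ∷ L)
    down : ∀ {L} → Zigzag 0ℤ L → Zigzag 1ℤ (-1ℤ ∷ L)

  bitStep⇒trit : ∀ s x → Bit s → Bit (s + x) → Trit x
  bitStep⇒trit s x (inj₁ refl) (inj₁ e) = inj₂ (inj₁ (trans (sym (ℤP.+-identityˡ x)) e))
  bitStep⇒trit s x (inj₁ refl) (inj₂ e) = inj₂ (inj₂ (trans (sym (ℤP.+-identityˡ x)) e))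
  bitStep⇒trit s x (inj₂ refl) (inj₁ e) = inj₁ (+-cancelˡ 1ℤ e)
  bitStep⇒trit s x (inj₂ refl) (inj₂ e) = inj₂ (inj₁ (+-cancelˡ 1ℤ e))

  bitWalk⇒zigzag : ∀ s xs → Bit s → BitWalk s xs → Zigzag s (nonzeros xs)
  bitWalk⇒zigzag s []       b           refl          = done
  bitWalk⇒zigzag s (x ∷ xs) b           (b′ , w) with bitStep⇒trit s x b b′
  bitWalk⇒zigzag s (x ∷ xs) (inj₁ refl) (inj₁ () , w) | inj₁ refl
  bitWalk⇒zigzag s (x ∷ xs) (inj₁ refl) (inj₂ () , w) | inj₁ refl
  bitWalk⇒zigzag s (x ∷ xs) (inj₂ refl) (b′ , w)      | inj₁ refl        = down (bitWalk⇒zigzag _ xs b′ w)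
  bitWalk⇒zigzag s (x ∷ xs) (inj₁ refl) (b′ , w)      | inj₂ (inj₁ refl) = bitWalk⇒zigzag _ xs b′ w
  bitWalk⇒zigzag s (x ∷ xs) (inj₂ refl) (b′ , w)      | inj₂ (inj₁ refl) = bitWalk⇒zigzag _ xs b′ w
  bitWalk⇒zigzag s (x ∷ xs) (inj₁ refl) (b′ , w)      | inj₂ (inj₂ refl) = up (bitWalk⇒zigzag _ xs b′ w)
  bitWalk⇒zigzag s (x ∷ xs) (inj₂ refl) (inj₁ () , w) | inj₂ (inj₂ refl)
  bitWalk⇒zigzag s (x ∷ xs) (inj₂ refl) (inj₂ () , w) | inj₂ (inj₂ refl)

  zigzag⇒bitWalk : ∀ s xs → Bit s → All Trit xs → Zigzag s (nonzeros xs) → BitWalk s xs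
  zigzag⇒bitWalk s []       b           []                      done     = refl
  zigzag⇒bitWalk s (x ∷ xs) (inj₁ refl) (inj₁ refl ∷ ts)        ()
  zigzag⇒bitWalk s (x ∷ xs) (inj₂ refl) (inj₁ refl ∷ ts)        (down z) = inj₁ refl , zigzag⇒bitWalk _ xs (inj₁ refl) ts z
  zigzag⇒bitWalk s (x ∷ xs) (inj₁ refl) (inj₂ (inj₁ refl) ∷ ts) z        = inj₁ refl , zigzag⇒bitWalk _ xs (inj₁ refl) ts z
  zigzag⇒bitWalk s (x ∷ xs) (inj₂ refl) (inj₂ (inj₁ refl) ∷ ts) z        = inj₂ refl , zigzag⇒bitWalk _ xs (inj₂ refl) ts z
  zigzag⇒bitWalk s (x ∷ xs) (inj₁ refl) (inj₂ (inj₂ refl) ∷ ts) (up z)   = inj₂ refl , zigzag⇒bitWalk _ xs (inj₂ refl) ts z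
  zigzag⇒bitWalk s (x ∷ xs) (inj₂ refl) (inj₂ (inj₂ refl) ∷ ts) ()

  sumList : List ℤ → ℤ
  sumList = foldr _+_ 0ℤ

  zigzag-alternatingˡ : ∀ {L} → Zigzag 1ℤ L → Alternating (1ℤ ∷ L)
  zigzag-alternatingʳ : ∀ {L} → Zigzag 0ℤ L → Alternating (-1ℤ ∷ L)
  zigzag-alternatingˡ done     = tt
  zigzag-alternatingˡ (down z) = refl , zigzag-alternatingʳ z
  zigzag-alternatingʳ (up z)   = refl , zigzag-alternatingˡ z

  zigzag-sum₀ : ∀ {L} → Zigzag 0ℤ L → sumList L ≡ 1ℤ
  zigzag-sum₁ : ∀ {L} → Zigzag 1ℤ L → sumList L ≡ 0ℤ
  zigzag-sum₀ (up z)   = cong (_+_ 1ℤ) (zigzag-sum₁ z)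
  zigzag-sum₁ done     = refl
  zigzag-sum₁ (down z) = cong (_+_ -1ℤ) (zigzag-sum₀ z)

  zigzag⇒goodLine : ∀ xs → Zigzag 0ℤ (nonzeros xs) → GoodLine xs
  zigzag⇒goodLine xs z with nonzeros xs
  zigzag⇒goodLine xs (up z) | .(1ℤ ∷ _) = zigzag-alternatingˡ z , zigzag-sum₀ (up z)

  alternating⁺ : ∀ L → Alternating (1ℤ ∷ L) → Zigzag 0ℤ (1ℤ ∷ L) ⊎ sumList (1ℤ ∷ L) ≡ 0ℤ
  alternating⁻ : ∀ L → Alternating (-1ℤ ∷ L) → Zigzag 1ℤ (-1ℤ ∷ L) ⊎ sumList (-1ℤ ∷ L) ≡ -1ℤ
  alternating⁺ []      _        = inj₁ (up done)
  alternating⁺ (y ∷ L) (refl , a) with alternating⁻ L a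
  ... | inj₁ (down z) = inj₁ (up (down z))
  ... | inj₂ e        = inj₂ (cong (_+_ 1ℤ) e)
  alternating⁻ []      _        = inj₂ refl
  alternating⁻ (y ∷ L) (refl , a) with alternating⁺ L a
  ... | inj₁ (up z)   = inj₁ (down (up z))
  ... | inj₂ e        = inj₂ (cong (_+_ -1ℤ) e)

  nonzeros-sign : ∀ xs → All Trit xs → All Sign (nonzeros xs)
  nonzeros-sign []       []                      = []
  nonzeros-sign (x ∷ xs) (inj₁ refl ∷ ts)        = inj₂ refl ∷ nonzeros-sign xs ts
  nonzeros-sign (x ∷ xs) (inj₂ (inj₁ refl) ∷ ts) = nonzeros-sign xs ts
  nonzeros-sign (x ∷ xs) (inj₂ (inj₂ refl) ∷ ts) = inj₁ refl ∷ nonzeros-sign xs ts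

  alternating⇒zigzag : ∀ L → All Sign L → Alternating L → sumList L ≡ 1ℤ → Zigzag 0ℤ L
  alternating⇒zigzag []      _               a ()
  alternating⇒zigzag (x ∷ L) (inj₁ refl ∷ _) a s with alternating⁺ L a
  ... | inj₁ z = z
  ... | inj₂ e with trans (sym s) e
  ... | ()
  alternating⇒zigzag (x ∷ L) (inj₂ refl ∷ _) a s with alternating⁻ L a
  ... | inj₁ z with trans (sym s) (zigzag-sum₁ z)
  ... | ()
  alternating⇒zigzag (x ∷ L) (inj₂ refl ∷ _) a s | inj₂ e with trans (sym s) e
  ... | ()

  PrefixBits : ∀ n → ℤ → (Fin n → ℤ) → Set
  PrefixBits n s g = (∀ y → y ℕ.≤ n → Bit (s + sumTo y (extend 0ℤ g))) × (s + sumTo n (extend 0ℤ g) ≡ 1ℤ)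

  private
    shift : ∀ {n} (g : Fin (suc n) → ℤ) s y →
      s + sumTo (suc y) (extend 0ℤ g) ≡ (s + g zero) + sumTo y (extend 0ℤ (g ∘ suc))
    shift g s y = trans (cong (_+_ s) (sumTo-suc y (extend 0ℤ g))) (sym (ℤP.+-assoc s (g zero) _))

    bitAt0 : ∀ s → Bit s → Bit (s + 0ℤ)
    bitAt0 s = subst Bit (sym (ℤP.+-identityʳ s))

  bitWalk⇒prefixBits : ∀ n s (g : Fin n → ℤ) → Bit s → BitWalk s (L.tabulate g) → PrefixBits n s g
  bitWalk⇒prefixBits zero    s g b w        = (λ { zero _ → bitAt0 s b }) , trans (ℤP.+-identityʳ s) w
  bitWalk⇒prefixBits (suc n) s g b (b′ , w) with bitWalk⇒prefixBits n (s + g zero) (g ∘ suc) b′ w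
  ... | bits , total = bits′ , trans (shift g s n) total
    where
    bits′ : ∀ y → y ℕ.≤ suc n → Bit (s + sumTo y (extend 0ℤ g))
    bits′ zero    _       = bitAt0 s b
    bits′ (suc y) (s≤s q) = subst Bit (sym (shift g s y)) (bits y q)

  prefixBits⇒bitWalk : ∀ n s (g : Fin n → ℤ) → PrefixBits n s g → BitWalk s (L.tabulate g)
  prefixBits⇒bitWalk zero    s g (bits , total) = trans (sym (ℤP.+-identityʳ s)) total
  prefixBits⇒bitWalk (suc n) s g (bits , total) =
    first , prefixBits⇒bitWalk n (s + g zero) (g ∘ suc)
      ((λ y q → subst Bit (shift g s y) (bits (suc y) (s≤s q))) , trans (sym (shift g s n)) total)
    where
    first : Bit (s + g zero)
    first = subst Bit (trans (shift g s 0) (ℤP.+-identityʳ _)) (bits 1 (s≤s z≤n))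

  all-tabulate : ∀ {n} {P : ℤ → Set} (g : Fin n → ℤ) → (∀ b → P (g b)) → All P (L.tabulate g)
  all-tabulate {zero}  g h = []
  all-tabulate {suc n} g h = h zero ∷ all-tabulate (g ∘ suc) (h ∘ suc)

  goodLine⇒prefixBits : ∀ n (g : Fin n → ℤ) → (∀ b → Trit (g b)) → GoodLine (L.tabulate g) → PrefixBits n 0ℤ g
  goodLine⇒prefixBits n g tr (alt , total) =
    bitWalk⇒prefixBits n 0ℤ g (inj₁ refl)
      (zigzag⇒bitWalk 0ℤ (L.tabulate g) (inj₁ refl) (all-tabulate g tr)
        (alternating⇒zigzag _ (nonzeros-sign _ (all-tabulate g tr)) alt total))

  prefixBits⇒goodLine : ∀ n (g : Fin n → ℤ) → PrefixBits n 0ℤ g → GoodLine (L.tabulate g)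
  prefixBits⇒goodLine n g p =
    zigzag⇒goodLine (L.tabulate g) (bitWalk⇒zigzag 0ℤ _ (inj₁ refl) (prefixBits⇒bitWalk n 0ℤ g p))

open Lines

-- Rank functions

Step : ℕ → ℕ → Set
Step u v = v ≡ u ⊎ v ≡ suc u

-- s x y is the sum of the first x rows and y columns of the corresponding ASM.
record IsRankFunction (n : ℕ) (s : ℕ → ℕ → ℕ) : Set where
  field
    row₀      : ∀ y → s 0 y ≡ 0
    col₀      : ∀ x → s x 0 ≡ 0
    colₙ      : ∀ x → x ≤ n → s x n ≡ x
    rowₙ      : ∀ y → y ≤ n → s n y ≡ y
    stepDown  : ∀ x y → x < n → y ≤ n → Step (s x y) (s (suc x) y)
    stepRight : ∀ x y → x ≤ n → y < n → Step (s x y) (s x (suc y))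

record Rank (n : ℕ) (M : Mat n) : Set where
  field
    s       : ℕ → ℕ → ℕ
    isRank  : IsRankFunction n s
    corner≡ : ∀ x y → x ≤ n → y ≤ n → corner M x y ≡ + s x y

module RankFunctions where

  open import Data.Integer using (_+_)

  suc-minus-self : ∀ u → + suc u - + u ≡ 1ℤ
  suc-minus-self u = trans (cong (_- + u) (trans (ℤP.pos-+ 1 u) (ℤP.+-comm 1ℤ (+ u)))) (x+y-x≡y (+ u) 1ℤ)

  step⇒bit : ∀ {u v} → Step u v → Bit (+ v - + u)
  step⇒bit {u} (inj₁ refl) = inj₁ (ℤP.+-inverseʳ (+ u))
  step⇒bit {u} (inj₂ refl) = inj₂ (suc-minus-self u)

  bit⇒step : ∀ u v {b} → Bit b → + v ≡ + u + b → Step u v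
  bit⇒step u v (inj₁ refl) e = inj₁ (ℤP.+-injective (trans e (ℤP.+-identityʳ (+ u))))
  bit⇒step u v (inj₂ refl) e = inj₂ (ℤP.+-injective (trans e (trans (ℤP.+-comm (+ u) 1ℤ) (sym (ℤP.pos-+ 1 u)))))

  bit-diff : ∀ {p q} → Bit p → Bit q → Trit (p - q)
  bit-diff (inj₁ refl) (inj₁ refl) = inj₂ (inj₁ refl)
  bit-diff (inj₁ refl) (inj₂ refl) = inj₁ refl
  bit-diff (inj₂ refl) (inj₁ refl) = inj₂ (inj₂ refl)
  bit-diff (inj₂ refl) (inj₂ refl) = inj₂ (inj₁ refl)

  module FromASM {n} (A : Mat n) (asm : IsASM n A) where

    private
      trit : ∀ a b → Trit (A a b)
      trit = proj₁ asm

      rowBits : ∀ a → PrefixBits n 0ℤ (A a)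
      rowBits a = goodLine⇒prefixBits n (A a) (trit a) (proj₁ (proj₂ asm) a)

      colBits : ∀ b → PrefixBits n 0ℤ (λ a → A a b)
      colBits b = goodLine⇒prefixBits n (λ a → A a b) (λ a → trit a b) (proj₂ (proj₂ asm) b)

      rowPrefix≡ : ∀ {x} (p : x < n) y → 0ℤ + sumTo y (extend 0ℤ (A (fromℕ< p))) ≡ rowPrefix A x y
      rowPrefix≡ p y = trans (ℤP.+-identityˡ _)
        (trans (sym (rowPrefix-toℕ A (fromℕ< p) y)) (cong (λ t → rowPrefix A t y) (FP.toℕ-fromℕ< p)))

      colPrefix≡ : ∀ x {y} (p : y < n) → 0ℤ + sumTo x (extend 0ℤ (λ a → A a (fromℕ< p))) ≡ colPrefix A x y
      colPrefix≡ x p = trans (ℤP.+-identityˡ _)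
        (trans (sym (colPrefix-toℕ A x (fromℕ< p))) (cong (colPrefix A x) (FP.toℕ-fromℕ< p)))

      rowBit : ∀ x y → x < n → y ≤ n → Bit (rowPrefix A x y)
      rowBit x y p q = subst Bit (rowPrefix≡ p y) (proj₁ (rowBits (fromℕ< p)) y q)

      rowTotal : ∀ x → x < n → rowPrefix A x n ≡ 1ℤ
      rowTotal x p = trans (sym (rowPrefix≡ p n)) (proj₂ (rowBits (fromℕ< p)))

      colBit : ∀ x y → x ≤ n → y < n → Bit (colPrefix A x y)
      colBit x y q p = subst Bit (colPrefix≡ x p) (proj₁ (colBits (fromℕ< p)) x q)

      colTotal : ∀ y → y < n → colPrefix A n y ≡ 1ℤ
      colTotal y p = trans (sym (colPrefix≡ n p)) (proj₂ (colBits (fromℕ< p)))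

      corner-nonneg : ∀ x y → x ≤ n → y ≤ n → Σ ℕ λ t → corner A x y ≡ + t
      corner-nonneg zero    y _ _ = 0 , refl
      corner-nonneg (suc x) y p q with corner-nonneg x y (ℕP.<⇒≤ p) q | rowBit x y p q
      ... | t , e | inj₁ b = t , trans (cong₂ _+_ e b) (ℤP.+-identityʳ _)
      ... | t , e | inj₂ b = suc t , trans (cong₂ _+_ e b) (trans (ℤP.+-comm (+ t) 1ℤ) (sym (ℤP.pos-+ 1 t)))

    s : ℕ → ℕ → ℕ
    s x y = ∣ corner A x y ∣

    corner≡s : ∀ x y → x ≤ n → y ≤ n → corner A x y ≡ + s x y
    corner≡s x y p q with corner-nonneg x y p q
    ... | t , e rewrite e = refl

    private
      corner-lastCol : ∀ x → x ≤ n → corner A x n ≡ + x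
      corner-lastCol x p = trans (sumTo-cong x (λ a q → rowTotal a (ℕP.<-≤-trans q p))) (sumTo-const1 x)

      corner-lastRow : ∀ y → y ≤ n → corner A n y ≡ + y
      corner-lastRow zero    _ = sumTo-const0 n
      corner-lastRow (suc y) q = trans (corner-sucʳ A n y)
        (trans (cong₂ _+_ (corner-lastRow y (ℕP.<⇒≤ q)) (colTotal y q))
          (trans (ℤP.+-comm (+ y) 1ℤ) (sym (ℤP.pos-+ 1 y))))

    isRank : IsRankFunction n s
    isRank = record
      { row₀      = λ y → refl
      ; col₀      = λ x → cong ∣_∣ (sumTo-zero x (λ _ _ → refl))
      ; colₙ      = λ x p → ℤP.+-injective (trans (sym (corner≡s x n p ℕP.≤-refl)) (corner-lastCol x p))
      ; rowₙ      = λ y q → ℤP.+-injective (trans (sym (corner≡s n y ℕP.≤-refl q)) (corner-lastRow y q))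
      ; stepDown  = λ x y p q → bit⇒step _ _ (rowBit x y p q)
          (trans (sym (corner≡s (suc x) y p q)) (cong (_+ rowPrefix A x y) (corner≡s x y (ℕP.<⇒≤ p) q)))
      ; stepRight = λ x y p q → bit⇒step _ _ (colBit x y p q)
          (trans (sym (corner≡s x (suc y) p q))
            (trans (corner-sucʳ A x y) (cong (_+ colPrefix A x y) (corner≡s x y p (ℕP.<⇒≤ q)))))
      }

  -- Abstract so that the rank function is never unfolded into its defining sums.
  abstract
    asm⇒rank : ∀ {n} {A : Mat n} → IsASM n A → Rank n A
    asm⇒rank {A = A} asm = record { s = s ; isRank = isRank ; corner≡ = corner≡s }
      where open FromASM A asm

  fromRank : ∀ {n} → (ℕ → ℕ → ℕ) → Mat n
  fromRank s a b = let x = toℕ a ; y = toℕ b in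
    (+ s (suc x) (suc y) - + s x (suc y)) - (+ s (suc x) y - + s x y)

  module ToASM {n} (s : ℕ → ℕ → ℕ) (isRank : IsRankFunction n s) where
    open IsRankFunction isRank

    private
      M : Mat n
      M = fromRank s

      entry-M : ∀ x y → x < n → y < n → entry M x y ≡ (+ s (suc x) (suc y) - + s x (suc y)) - (+ s (suc x) y - + s x y)
      entry-M x y p q =
        trans (extend-cong 0ℤ (λ a → extend-fromℕ< 0ℤ (M a) q) x)
          (trans (extend-fromℕ< 0ℤ (λ a → M a (fromℕ< q)) p)
            (cong₂ (λ u v → (+ s (suc u) (suc v) - + s u (suc v)) - (+ s (suc u) v - + s u v))
              (FP.toℕ-fromℕ< p) (FP.toℕ-fromℕ< q)))

    corner-fromRank : ∀ x y → x ≤ n → y ≤ n → corner (fromRank {n} s) x y ≡ + s x y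
    corner-fromRank x y p q = begin
        corner M x y
      ≡⟨ sumTo-cong x (λ a pa → sumTo-cong y (λ b pb → entry-M a b (ℕP.<-≤-trans pa p) (ℕP.<-≤-trans pb q))) ⟩
        sumTo x (λ a → sumTo y (λ b → (+ s (suc a) (suc b) - + s a (suc b)) - (+ s (suc a) b - + s a b)))
      ≡⟨ sumTo-cong x (λ a _ → sumTo-telescope y (λ b → + s (suc a) b - + s a b)) ⟩
        sumTo x (λ a → (+ s (suc a) y - + s a y) - (+ s (suc a) 0 - + s a 0))
      ≡⟨ sumTo-cong x (λ a _ → cong₂ (λ u v → (+ s (suc a) y - + s a y) - (+ u - + v)) (col₀ (suc a)) (col₀ a)) ⟩
        sumTo x (λ a → (+ s (suc a) y - + s a y) - 0ℤ)
      ≡⟨ sumTo-cong x (λ a _ → ℤP.+-identityʳ _) ⟩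
        sumTo x (λ a → + s (suc a) y - + s a y)
      ≡⟨ sumTo-telescope x (λ a → + s a y) ⟩
        + s x y - + s 0 y
      ≡⟨ cong (λ u → + s x y - + u) (row₀ y) ⟩
        + s x y - 0ℤ
      ≡⟨ ℤP.+-identityʳ _ ⟩
        + s x y ∎
      where open ≡-Reasoning

    private
      rowPrefix≡ : ∀ x y → x < n → y ≤ n → rowPrefix M x y ≡ + s (suc x) y - + s x y
      rowPrefix≡ x y p q = trans (sym (x+y-x≡y (corner M x y) (rowPrefix M x y)))
        (cong₂ _-_ (corner-fromRank (suc x) y p q) (corner-fromRank x y (ℕP.<⇒≤ p) q))

      colPrefix≡ : ∀ x y → x ≤ n → y < n → colPrefix M x y ≡ + s x (suc y) - + s x y
      colPrefix≡ x y p q = trans (sym (x+y-x≡y (corner M x y) (colPrefix M x y)))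
        (cong₂ _-_ (trans (sym (corner-sucʳ M x y)) (corner-fromRank x (suc y) p q)) (corner-fromRank x y p (ℕP.<⇒≤ q)))

      rowWalk≡ : ∀ a y → y ≤ n → 0ℤ + sumTo y (extend 0ℤ (M a)) ≡ + s (suc (toℕ a)) y - + s (toℕ a) y
      rowWalk≡ a y q = trans (ℤP.+-identityˡ _) (trans (sym (rowPrefix-toℕ M a y)) (rowPrefix≡ (toℕ a) y (FP.toℕ<n a) q))

      colWalk≡ : ∀ b x → x ≤ n → 0ℤ + sumTo x (extend 0ℤ (λ a → M a b)) ≡ + s x (suc (toℕ b)) - + s x (toℕ b)
      colWalk≡ b x p = trans (ℤP.+-identityˡ _) (trans (sym (colPrefix-toℕ M x b)) (colPrefix≡ x (toℕ b) p (FP.toℕ<n b)))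

      rowBits : ∀ a → PrefixBits n 0ℤ (M a)
      rowBits a =
        (λ y q → subst Bit (sym (rowWalk≡ a y q)) (step⇒bit (stepDown (toℕ a) y (FP.toℕ<n a) q))) ,
        trans (rowWalk≡ a n ℕP.≤-refl)
          (trans (cong₂ (λ u v → + u - + v) (colₙ (suc (toℕ a)) (FP.toℕ<n a)) (colₙ (toℕ a) (ℕP.<⇒≤ (FP.toℕ<n a))))
            (suc-minus-self (toℕ a)))

      colBits : ∀ b → PrefixBits n 0ℤ (λ a → M a b)
      colBits b =
        (λ x p → subst Bit (sym (colWalk≡ b x p)) (step⇒bit (stepRight x (toℕ b) p (FP.toℕ<n b)))) ,
        trans (colWalk≡ b n ℕP.≤-refl)
          (trans (cong₂ (λ u v → + u - + v) (rowₙ (suc (toℕ b)) (FP.toℕ<n b)) (rowₙ (toℕ b) (ℕP.<⇒≤ (FP.toℕ<n b))))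
            (suc-minus-self (toℕ b)))

      trit : ∀ a b → Trit (M a b)
      trit a b = bit-diff (step⇒bit (stepDown (toℕ a) (suc (toℕ b)) (FP.toℕ<n a) (FP.toℕ<n b)))
                          (step⇒bit (stepDown (toℕ a) (toℕ b) (FP.toℕ<n a) (ℕP.<⇒≤ (FP.toℕ<n b))))

    fromRank-isASM : IsASM n (fromRank {n} s)
    fromRank-isASM = trit , (λ a → prefixBits⇒goodLine n (M a) (rowBits a))
                          , (λ b → prefixBits⇒goodLine n (λ a → M a b) (colBits b))

open RankFunctions

open import Data.Nat using (_+_)

steps⇒lipschitz : ∀ (f : ℕ → ℕ) m → (∀ k → k < m → Step (f k) (f (suc k))) →
  ∀ a b → a ≤ b → b ≤ m → f a ≤ f b × f b + a ≤ f a + b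
steps⇒lipschitz f m st zero    zero    _ _ = ℕP.≤-refl , ℕP.≤-refl
steps⇒lipschitz f m st a       (suc b) p q with a ℕ.≤? b
... | no a≰b with ℕP.≤-antisym p (ℕP.≰⇒> a≰b)
...   | refl = ℕP.≤-refl , ℕP.≤-refl
steps⇒lipschitz f m st a (suc b) p q | yes a≤b with steps⇒lipschitz f m st a b a≤b (ℕP.<⇒≤ q) | st b q
... | mono , lip | inj₁ e rewrite e = mono , ℕP.≤-trans lip (ℕP.+-monoʳ-≤ (f a) (ℕP.n≤1+n b))
... | mono , lip | inj₂ e rewrite e =
  ℕP.≤-trans mono (ℕP.n≤1+n _) , ℕP.≤-trans (s≤s lip) (ℕP.≤-reflexive (sym (ℕP.+-suc (f a) b)))

module RankFacts {n s} (isRank : IsRankFunction n s) where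
  open IsRankFunction isRank

  lipschitzRight : ∀ x → x ≤ n → ∀ a b → a ≤ b → b ≤ n → s x a ≤ s x b × s x b + a ≤ s x a + b
  lipschitzRight x p = steps⇒lipschitz (s x) n (λ k q → stepRight x k p q)

  monoDown : ∀ a b y → a ≤ b → b ≤ n → y ≤ n → s a y ≤ s b y
  monoDown a b y p q r = proj₁ (steps⇒lipschitz (λ x → s x y) n (λ k p → stepDown k y p r) a b p q)

  monoRight : ∀ x a b → a ≤ b → b ≤ n → x ≤ n → s x a ≤ s x b
  monoRight x a b p q r = proj₁ (lipschitzRight x r a b p q)

  stepDown-≤ : ∀ x y → x < n → y ≤ n → s (suc x) y ≤ suc (s x y)
  stepDown-≤ x y p q with stepDown x y p q
  ... | inj₁ e = ℕP.≤-trans (ℕP.≤-reflexive e) (ℕP.n≤1+n _)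
  ... | inj₂ e = ℕP.≤-reflexive e

gridCases : ∀ {n} x y → x ≤ n → y ≤ n →
  (x ≡ 0 ⊎ y ≡ 0) ⊎ Σ (Fin n) λ a → Σ (Fin n) λ b → x ≡ suc (toℕ a) × y ≡ suc (toℕ b)
gridCases zero    y       p q = inj₁ (inj₁ refl)
gridCases (suc x) zero    p q = inj₁ (inj₂ refl)
gridCases (suc x) (suc y) p q =
  inj₂ (fromℕ< p , fromℕ< q , cong suc (sym (FP.toℕ-fromℕ< p)) , cong suc (sym (FP.toℕ-fromℕ< q)))

record NatCorners (n : ℕ) (M : Mat n) : Set where
  field
    s       : ℕ → ℕ → ℕ
    row₀    : ∀ y → s 0 y ≡ 0
    col₀    : ∀ x → s x 0 ≡ 0
    corner≡ : ∀ x y → x ≤ n → y ≤ n → corner M x y ≡ + s x y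

  rk≡ : ∀ a b → rk M a b ≡ + s (suc (toℕ a)) (suc (toℕ b))
  rk≡ a b = trans (rk≡corner M a b) (corner≡ _ _ (FP.toℕ<n a) (FP.toℕ<n b))

rank⇒natCorners : ∀ {n} {M : Mat n} → Rank n M → NatCorners n M
rank⇒natCorners K = record { s = s ; row₀ = row₀ ; col₀ = col₀ ; corner≡ = corner≡ }
  where
  open Rank K
  open IsRankFunction isRank

module CompareCorners {n} {M M′ : Mat n} (K : NatCorners n M) (K′ : NatCorners n M′) where
  open NatCorners K using (s; rk≡; row₀; col₀)
  open NatCorners K′ renaming (s to s′; rk≡ to rk′≡; row₀ to row₀′; col₀ to col₀′)

  agreeOffRow : (i : Fin n) → (∀ a b → a ≢ i → rk M a b ≡ rk M′ a b) →
    ∀ x y → x ≤ n → y ≤ n → x ≢ suc (toℕ i) → s x y ≡ s′ x y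
  agreeOffRow i e x y p q x≢ with gridCases x y p q
  ... | inj₁ (inj₁ refl) = trans (row₀ y) (sym (row₀′ y))
  ... | inj₁ (inj₂ refl) = trans (col₀ x) (sym (col₀′ x))
  ... | inj₂ (a , b , refl , refl) =
    ℤP.+-injective (trans (sym (rk≡ a b)) (trans (e a b (λ { refl → x≢ refl })) (rk′≡ a b)))

  ≤ₛ⇒≥ : M ≤ₛ M′ → ∀ x y → x ≤ n → y ≤ n → s′ x y ≤ s x y
  ≤ₛ⇒≥ le x y p q with gridCases x y p q
  ... | inj₁ (inj₁ refl) = ℕP.≤-reflexive (trans (row₀′ y) (sym (row₀ y)))
  ... | inj₁ (inj₂ refl) = ℕP.≤-reflexive (trans (col₀′ x) (sym (col₀ x)))
  ... | inj₂ (a , b , refl , refl) = ℤP.drop‿+≤+ (subst₂ ℤ._≤_ (rk′≡ a b) (rk≡ a b) (le a b))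

  ≥⇒≤ₛ : (∀ x y → x ≤ n → y ≤ n → s′ x y ≤ s x y) → M ≤ₛ M′
  ≥⇒≤ₛ le a b = subst₂ ℤ._≤_ (sym (rk′≡ a b)) (sym (rk≡ a b)) (ℤ.+≤+ (le _ _ (FP.toℕ<n a) (FP.toℕ<n b)))

  ≡⇒≡ₘ : (∀ x y → x ≤ n → y ≤ n → s x y ≡ s′ x y) → M ≡ₘ M′
  ≡⇒≡ₘ e = corner-injective (λ x y p q →
    trans (NatCorners.corner≡ K x y p q) (trans (cong +_ (e x y p q)) (sym (NatCorners.corner≡ K′ x y p q))))

-- The projection π_i

Step-suc : ∀ {u v} → Step u v → Step (suc u) (suc v)
Step-suc (inj₁ refl) = inj₁ refl
Step-suc (inj₂ refl) = inj₂ refl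

Step-⊓ : ∀ {a a′ b b′} → Step a a′ → Step b b′ → Step (a ⊓ b) (a′ ⊓ b′)
Step-⊓         (inj₁ refl) (inj₁ refl) = inj₁ refl
Step-⊓         (inj₂ refl) (inj₂ refl) = inj₂ refl
Step-⊓ {a} {b = b} (inj₂ refl) (inj₁ refl) with a ℕ.<? b
... | yes a<b rewrite ℕP.m≤n⇒m⊓n≡m (ℕP.<⇒≤ a<b) | ℕP.m≤n⇒m⊓n≡m a<b = inj₂ refl
... | no  a≮b rewrite ℕP.m≥n⇒m⊓n≡n (ℕP.≮⇒≥ a≮b) | ℕP.m≥n⇒m⊓n≡n (ℕP.m≤n⇒m≤1+n (ℕP.≮⇒≥ a≮b)) = inj₁ refl
Step-⊓ {a} {b = b} (inj₁ refl) (inj₂ refl) with b ℕ.<? a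
... | yes b<a rewrite ℕP.m≥n⇒m⊓n≡n (ℕP.<⇒≤ b<a) | ℕP.m≥n⇒m⊓n≡n b<a = inj₂ refl
... | no  b≮a rewrite ℕP.m≤n⇒m⊓n≡m (ℕP.≮⇒≥ b≮a) | ℕP.m≤n⇒m⊓n≡m (ℕP.m≤n⇒m≤1+n (ℕP.≮⇒≥ b≮a)) = inj₁ refl

Step-⊓ˡ : ∀ a b → a ≤ b → b ≤ suc (suc a) → Step a (suc a ⊓ b)
Step-⊓ˡ a b p q with suc a ℕ.≤? b
... | yes r = inj₂ (ℕP.m≤n⇒m⊓n≡m r)
... | no  r rewrite ℕP.m≥n⇒m⊓n≡n (ℕP.<⇒≤ (ℕP.≰⇒> r)) = inj₁ (ℕP.≤-antisym (ℕP.≤-pred (ℕP.≰⇒> r)) p)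

Step-⊓ʳ : ∀ a b → a ≤ b → b ≤ suc (suc a) → Step (suc a ⊓ b) b
Step-⊓ʳ a b p q with suc a ℕ.≤? b
... | no  r rewrite ℕP.m≥n⇒m⊓n≡n (ℕP.<⇒≤ (ℕP.≰⇒> r)) = inj₁ refl
... | yes r rewrite ℕP.m≤n⇒m⊓n≡m r with ℕP.m≤n⇒m<n∨m≡n r
...   | inj₂ e  = inj₁ (sym e)
...   | inj₁ r′ = inj₂ (ℕP.≤-antisym q r′)

-- The rank function of π_i(A): row I + 1 of s is raised to the largest value that the step
-- conditions allow between rows I and I + 2.
πRank : (ℕ → ℕ → ℕ) → ℕ → ℕ → ℕ → ℕ
πRank s I x y = if does (x ℕ.≟ suc I) then suc (s I y) ⊓ s (suc (suc I)) y else s x y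

πRank-row : ∀ s I y → πRank s I (suc I) y ≡ suc (s I y) ⊓ s (suc (suc I)) y
πRank-row s I y rewrite dec-true (suc I ℕ.≟ suc I) refl = refl

πRank-off : ∀ s I {x} y → x ≢ suc I → πRank s I x y ≡ s x y
πRank-off s I {x} y x≢ rewrite dec-false (x ℕ.≟ suc I) x≢ = refl

module Projection {n s} (isRank : IsRankFunction n s) (I : ℕ) (h : suc I < n) where
  open IsRankFunction isRank
  open RankFacts isRank

  private
    J : ℕ
    J = suc I

    I≤n : I ≤ n
    I≤n = ℕP.<⇒≤ (ℕP.<-trans (ℕP.n<1+n I) h)

    between : ∀ y → y ≤ n → s I y ≤ s (suc J) y × s (suc J) y ≤ suc (suc (s I y))
    between y q = monoDown I (suc J) y (ℕP.m≤n⇒m≤1+n (ℕP.n≤1+n I)) h q ,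
                  ℕP.≤-trans (stepDown-≤ J y h q) (s≤s (stepDown-≤ I y (ℕP.<-trans (ℕP.n<1+n I) h) q))

    s′ : ℕ → ℕ → ℕ
    s′ = πRank s I

    col₀′ : ∀ x → s′ x 0 ≡ 0
    col₀′ x with x ℕ.≟ J
    ... | yes refl = trans (πRank-row s I 0) (cong₂ _⊓_ (cong suc (col₀ I)) (col₀ (suc J)))
    ... | no  x≢   = trans (πRank-off s I 0 x≢) (col₀ x)

    colₙ′ : ∀ x → x ≤ n → s′ x n ≡ x
    colₙ′ x p with x ℕ.≟ J
    ... | yes refl = trans (πRank-row s I n)
                       (trans (cong₂ _⊓_ (cong suc (colₙ I I≤n)) (colₙ (suc J) h)) (ℕP.m≤n⇒m⊓n≡m (ℕP.n≤1+n J)))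
    ... | no  x≢   = trans (πRank-off s I n x≢) (colₙ x p)

    stepDown′ : ∀ x y → x < n → y ≤ n → Step (s′ x y) (s′ (suc x) y)
    stepDown′ x y p q with x ℕ.≟ J | suc x ℕ.≟ J
    ... | yes refl | yes e  = ⊥-elim (ℕP.<-irrefl (sym e) (ℕP.n<1+n J))
    ... | yes refl | no  x≢ rewrite πRank-row s I y | πRank-off s I y x≢ =
      Step-⊓ʳ (s I y) (s (suc J) y) (proj₁ (between y q)) (proj₂ (between y q))
    ... | no  x≢   | yes refl rewrite πRank-row s I y | πRank-off s I y x≢ =
      Step-⊓ˡ (s I y) (s (suc J) y) (proj₁ (between y q)) (proj₂ (between y q))
    ... | no  x≢   | no  x≢′  rewrite πRank-off s I y x≢ | πRank-off s I y x≢′ = stepDown x y p q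

    stepRight′ : ∀ x y → x ≤ n → y < n → Step (s′ x y) (s′ x (suc y))
    stepRight′ x y p q with x ℕ.≟ J
    ... | yes refl rewrite πRank-row s I y | πRank-row s I (suc y) =
      Step-⊓ (Step-suc (stepRight I y I≤n q)) (stepRight (suc J) y h q)
    ... | no  x≢   rewrite πRank-off s I y x≢ | πRank-off s I (suc y) x≢ = stepRight x y p q

  πRank-isRank : IsRankFunction n (πRank s I)
  πRank-isRank = record
    { row₀      = λ y → trans (πRank-off s I y (λ ())) (row₀ y)
    ; col₀      = col₀′
    ; colₙ      = colₙ′
    ; rowₙ      = λ y q → trans (πRank-off s I y (λ e → ℕP.<-irrefl (sym e) h)) (rowₙ y q)
    ; stepDown  = stepDown′
    ; stepRight = stepRight′
    }

DescentColumn : ℕ → (ℕ → ℕ → ℕ) → ℕ → Set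
DescentColumn n s I = Σ ℕ λ c → c ≤ n × s I c ≡ s (suc I) c × s (suc (suc I)) c ≡ suc (s (suc I) c)

module ProjectionOfASM {n} {A : Mat n} (asm : IsASM n A) (i : Fin n) (h : suc (toℕ i) < n) where

  rankA : Rank n A
  rankA = asm⇒rank asm

  open Rank rankA using (s; isRank)
  open IsRankFunction isRank
  open Projection isRank (toℕ i) h

  private
    I J : ℕ
    I = toℕ i
    J = suc I

    I≤n : I ≤ n
    I≤n = ℕP.<⇒≤ (ℕP.<-trans (ℕP.n<1+n I) h)

    I≢J : I ≢ J
    I≢J e = ℕP.<-irrefl e (ℕP.n<1+n I)

    J+1≢J : suc J ≢ J
    J+1≢J e = ℕP.<-irrefl (sym e) (ℕP.n<1+n J)

    cornersA : NatCorners n A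
    cornersA = rank⇒natCorners rankA

  π : Mat n
  π = fromRank (πRank s I)

  rankπ : Rank n π
  rankπ = record { s = πRank s I ; isRank = πRank-isRank ; corner≡ = ToASM.corner-fromRank (πRank s I) πRank-isRank }

  π-isPi : IsPi A i π
  π-isPi = (ToASM.fromRank-isASM (πRank s I) πRank-isRank , rk-off) , minimal
    where
    cornersπ : NatCorners n π
    cornersπ = rank⇒natCorners rankπ

    rk-off : ∀ a b → a ≢ i → rk π a b ≡ rk A a b
    rk-off a b a≢i = trans (NatCorners.rk≡ cornersπ a b)
      (trans (cong +_ (πRank-off s I _ (a≢i ∘ FP.toℕ-injective ∘ ℕP.suc-injective))) (sym (NatCorners.rk≡ cornersA a b)))

    minimal : ∀ B → SameRkOff A i B → π ≤ₛ B
    minimal B (asmB , rk-offB) = CompareCorners.≥⇒≤ₛ cornersπ (rank⇒natCorners rankB) le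
      where
      rankB : Rank n B
      rankB = asm⇒rank asmB
      sB : ℕ → ℕ → ℕ
      sB = Rank.s rankB
      open RankFacts (Rank.isRank rankB) using () renaming (stepDown-≤ to stepDownB-≤; monoDown to monoDownB)

      agree : ∀ x y → x ≤ n → y ≤ n → x ≢ J → sB x y ≡ s x y
      agree = CompareCorners.agreeOffRow (rank⇒natCorners rankB) cornersA i rk-offB

      le : ∀ x y → x ≤ n → y ≤ n → sB x y ≤ πRank s I x y
      le x y p q with x ℕ.≟ J
      ... | no  x≢ rewrite πRank-off s I y x≢ = ℕP.≤-reflexive (agree x y p q x≢)
      ... | yes refl rewrite πRank-row s I y = ℕP.⊓-glb
        (ℕP.≤-trans (stepDownB-≤ I y (ℕP.<-trans (ℕP.n<1+n I) h) q) (s≤s (ℕP.≤-reflexive (agree I y I≤n q I≢J))))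
        (ℕP.≤-trans (monoDownB J (suc J) y (ℕP.n≤1+n J) h q) (ℕP.≤-reflexive (agree (suc J) y h q J+1≢J)))

  π≡A⇒row : π ≡ₘ A → ∀ y → y ≤ n → s J y ≡ suc (s I y) ⊓ s (suc J) y
  π≡A⇒row e y q = trans (sym (ℤP.+-injective
    (trans (sym (Rank.corner≡ rankπ J y (ℕP.<⇒≤ h) q))
      (trans (corner-cong e J y) (Rank.corner≡ rankA J y (ℕP.<⇒≤ h) q))))) (πRank-row s I y)

  module _ {P : Mat n} (isPi : IsPi A i P) where

    private
      rankP : Rank n P
      rankP = asm⇒rank (proj₁ (proj₁ isPi))
      sP : ℕ → ℕ → ℕ
      sP = Rank.s rankP
      cornersP : NatCorners n P
      cornersP = rank⇒natCorners rankP
      open RankFacts (Rank.isRank rankP) using () renaming (stepDown-≤ to stepDownP-≤; monoDown to monoDownP)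

      s≤sP : ∀ x y → x ≤ n → y ≤ n → s x y ≤ sP x y
      s≤sP = CompareCorners.≤ₛ⇒≥ cornersP cornersA (proj₂ isPi A (asm , λ _ _ _ → refl))

      agree : ∀ x y → x ≤ n → y ≤ n → x ≢ J → sP x y ≡ s x y
      agree = CompareCorners.agreeOffRow cornersP cornersA i (proj₂ (proj₁ isPi))

      -- Row J of sP lies between s J y and min (s I y + 1) (s (J + 1) y), so it can exceed s J y only
      -- where s is flat from row I to row J and rises from row J to row J + 1.
      raised⇒descentColumn : ∀ y → y ≤ n → sP J y ≢ s J y → DescentColumn n s I
      raised⇒descentColumn y q ≢ = y , q , flat (stepDown I y I<n q) , rises (stepDown J y h q)
        where
        I<n : I < n
        I<n = ℕP.<-trans (ℕP.n<1+n I) h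
        raised : s J y < sP J y
        raised = ℕP.≤∧≢⇒< (s≤sP J y (ℕP.<⇒≤ h) q) (≢ ∘ sym)
        flat : Step (s I y) (s J y) → s I y ≡ s J y
        flat (inj₁ e) = sym e
        flat (inj₂ e) = ⊥-elim (ℕP.<⇒≱ raised (ℕP.≤-trans (stepDownP-≤ I y I<n q)
                          (ℕP.≤-trans (s≤s (ℕP.≤-reflexive (agree I y I≤n q I≢J))) (ℕP.≤-reflexive (sym e)))))
        rises : Step (s J y) (s (suc J) y) → s (suc J) y ≡ suc (s J y)
        rises (inj₂ e) = e
        rises (inj₁ e) = ⊥-elim (ℕP.<⇒≱ raised (ℕP.≤-trans (monoDownP J (suc J) y (ℕP.n≤1+n J) h q)
                           (ℕP.≤-reflexive (trans (agree (suc J) y h q J+1≢J) e))))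

    isPi-≢⇒descentColumn : ¬ (P ≡ₘ A) → DescentColumn n s I
    isPi-≢⇒descentColumn P≢A with FP.all? (λ (y : Fin (suc n)) → sP J (toℕ y) ℕ.≟ s J (toℕ y))
    ... | yes rowJ-equal = ⊥-elim (P≢A (CompareCorners.≡⇒≡ₘ cornersP cornersA equal))
      where
      equal : ∀ x y → x ≤ n → y ≤ n → sP x y ≡ s x y
      equal x y p q with x ℕ.≟ J
      ... | no  x≢   = agree x y p q x≢
      ... | yes refl = subst (λ t → sP J t ≡ s J t) (FP.toℕ-fromℕ< (s≤s q)) (rowJ-equal (fromℕ< (s≤s q)))
    ... | no rowJ-differs with FP.¬∀⟶∃¬ (suc n) _ (λ y → sP J (toℕ y) ℕ.≟ s J (toℕ y)) rowJ-differs
    ...   | y , differs = raised⇒descentColumn (toℕ y) (ℕP.≤-pred (FP.toℕ<n y)) differs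

  asmDescent⇒descentColumn : ASMDescent A i → DescentColumn n s I
  asmDescent⇒descentColumn (P , isPi , P≢A) = isPi-≢⇒descentColumn isPi P≢A

indicator : ∀ {p} {P : Set p} → Dec P → ℕ
indicator d = if does d then 1 else 0

indicator-yes : ∀ {p} {P : Set p} (d : Dec P) → P → indicator d ≡ 1
indicator-yes (yes _) _ = refl
indicator-yes (no ¬p) p = ⊥-elim (¬p p)

indicator-no : ∀ {p} {P : Set p} (d : Dec P) → ¬ P → indicator d ≡ 0
indicator-no (yes p) ¬p = ⊥-elim (¬p p)
indicator-no (no _)  _  = refl

indicator-≤1 : ∀ {p} {P : Set p} (d : Dec P) → indicator d ≤ 1
indicator-≤1 (yes _) = ℕP.≤-refl
indicator-≤1 (no _)  = z≤n

indicator≡0 : ∀ {p} {P : Set p} (d : Dec P) → indicator d ≡ 0 → ¬ P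
indicator≡0 (no ¬p) _ = ¬p

indicator≡1 : ∀ {p} {P : Set p} (d : Dec P) → indicator d ≡ 1 → P
indicator≡1 (yes p) _ = p

funMat : ∀ {n} → (Fin n → Fin n) → Mat n
funMat f a b = if ⌊ f a F.≟ b ⌋ then 1ℤ else 0ℤ

below : ∀ {n} → (Fin n → Fin n) → ℕ → Fin n → ℕ
below f y a = indicator (toℕ (f a) ℕ.<? y)

-- count f x y = #{a < x ∣ f a < y}, the corner sums of funMat f.
count : ∀ {n} → (Fin n → Fin n) → ℕ → ℕ → ℕ
count f zero    y = 0
count f (suc x) y = count f x y + extend 0 (below f y) x

count-row : ∀ {n} (f : Fin n → Fin n) a y → count f (suc (toℕ a)) y ≡ count f (toℕ a) y + below f y a
count-row f a y = cong (_+_ (count f (toℕ a) y)) (extend-toℕ 0 (below f y) a)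

count-col₀ : ∀ {n} (f : Fin n → Fin n) x → count f x 0 ≡ 0
count-col₀     f zero    = refl
count-col₀ {n} f (suc x) rewrite count-col₀ f x =
  trans (extend-cong 0 (λ a → indicator-no (toℕ (f a) ℕ.<? 0) (λ ())) x) (extend-const 0 n x)

unit-hit : ∀ {n} (t b : Fin n) → t ≡ b → (if ⌊ t F.≟ b ⌋ then 1ℤ else 0ℤ) ≡ 1ℤ
unit-hit t b e with t F.≟ b
... | yes _ = refl
... | no ne = ⊥-elim (ne e)

unit-miss : ∀ {n} (t b : Fin n) → t ≢ b → (if ⌊ t F.≟ b ⌋ then 1ℤ else 0ℤ) ≡ 0ℤ
unit-miss t b ne with t F.≟ b
... | yes e = ⊥-elim (ne e)
... | no _  = refl

unitRow-prefix : ∀ {n} (t : Fin n) y → y ≤ n →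
  sumTo y (extend 0ℤ (λ b → if ⌊ t F.≟ b ⌋ then 1ℤ else 0ℤ)) ≡ + indicator (toℕ t ℕ.<? y)
unitRow-prefix t zero    q = sym (cong +_ (indicator-no (toℕ t ℕ.<? 0) (λ ())))
unitRow-prefix t (suc y) q
  rewrite unitRow-prefix t y (ℕP.<⇒≤ q) | extend-fromℕ< 0ℤ (λ b → if ⌊ t F.≟ b ⌋ then 1ℤ else 0ℤ) q
  with ℕP.<-cmp (toℕ t) y
... | tri< t<y _ _
  rewrite indicator-yes (toℕ t ℕ.<? y) t<y | indicator-yes (toℕ t ℕ.<? suc y) (ℕP.m≤n⇒m≤1+n t<y)
        | unit-miss t (fromℕ< q) (λ e → ℕP.<-irrefl (trans (cong toℕ e) (FP.toℕ-fromℕ< q)) t<y) = refl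
... | tri≈ _ t≡y _
  rewrite indicator-no (toℕ t ℕ.<? y) (ℕP.<-irrefl t≡y) | indicator-yes (toℕ t ℕ.<? suc y) (s≤s (ℕP.≤-reflexive t≡y))
        | unit-hit t (fromℕ< q) (FP.toℕ-injective (trans t≡y (sym (FP.toℕ-fromℕ< q)))) = refl
... | tri> _ _ y<t
  rewrite indicator-no (toℕ t ℕ.<? y) (ℕP.<-asym y<t) | indicator-no (toℕ t ℕ.<? suc y) (ℕP.<⇒≱ y<t ∘ ℕP.≤-pred)
        | unit-miss t (fromℕ< q) (λ e → ℕP.<-irrefl (sym (trans (cong toℕ e) (FP.toℕ-fromℕ< q))) y<t) = refl

funMat-rowPrefix : ∀ {n} (f : Fin n → Fin n) x y → y ≤ n →
  rowPrefix (funMat f) x y ≡ + extend 0 (below f y) x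
funMat-rowPrefix {n} f x y q with x ℕ.<? n
... | yes x<n = begin
    rowPrefix (funMat f) x y          ≡⟨ cong (λ t → rowPrefix (funMat f) t y) (sym (FP.toℕ-fromℕ< x<n)) ⟩
    rowPrefix (funMat f) (toℕ a) y    ≡⟨ rowPrefix-toℕ (funMat f) a y ⟩
    sumTo y (extend 0ℤ (funMat f a))  ≡⟨ unitRow-prefix (f a) y q ⟩
    + below f y a                     ≡⟨ cong +_ (sym (extend-fromℕ< 0 (below f y) x<n)) ⟩
    + extend 0 (below f y) x          ∎
  where
  open ≡-Reasoning
  a : Fin n
  a = fromℕ< x<n
... | no x≮n = trans (sumTo-zero y (λ b _ → extend-≥ 0ℤ _ (ℕP.≮⇒≥ x≮n)))
                     (cong +_ (sym (extend-≥ 0 (below f y) (ℕP.≮⇒≥ x≮n))))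

funMat-corner : ∀ {n} (f : Fin n → Fin n) x y → y ≤ n → corner (funMat f) x y ≡ + count f x y
funMat-corner f zero    y q = refl
funMat-corner f (suc x) y q =
  trans (cong₂ ℤ._+_ (funMat-corner f x y q) (funMat-rowPrefix f x y q)) (sym (ℤP.pos-+ (count f x y) _))

funMat-corners : ∀ {n} (f : Fin n → Fin n) → NatCorners n (funMat f)
funMat-corners f = record
  { s = count f ; row₀ = λ _ → refl ; col₀ = count-col₀ f ; corner≡ = λ x y _ q → funMat-corner f x y q }

injective⇒surjective : ∀ {n} {f : Fin n → Fin n} → Injective _≡_ _≡_ f → ∀ y → Σ (Fin n) λ a → f a ≡ y
injective⇒surjective {suc m} {f} inj y with FP.any? (λ a → f a F.≟ y)
... | yes hit = hit
... | no miss with FP.pigeonhole (ℕP.n<1+n m) (λ a → F.punchOut {i = y} {j = f a} (λ e → miss (a , sym e)))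
...   | a , b , a<b , e = ⊥-elim (ℕP.<-irrefl (cong toℕ (inj
          (FP.punchOut-injective {i = y} (λ e′ → miss (a , sym e′)) (λ e′ → miss (b , sym e′)) e))) a<b)

injective⇒permutation : ∀ {n} (f : Fin n → Fin n) → Injective _≡_ _≡_ f →
  Σ (Permutation′ n) λ w → ∀ a → w ⟨$⟩ʳ a ≡ f a
injective⇒permutation f inj =
  permutation f (proj₁ ∘ surj) (proj₂ ∘ surj) (λ x → inj (proj₂ (surj (f x)))) , λ _ → refl
  where
  surj : ∀ y → Σ (Fin _) λ a → f a ≡ y
  surj = injective⇒surjective inj

permutation-injective : ∀ {n} (w : Permutation′ n) → Injective _≡_ _≡_ (w ⟨$⟩ʳ_)
permutation-injective w e = trans (sym (inverseˡ w)) (trans (cong (w ⟨$⟩ˡ_) e) (inverseˡ w))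

-- Swapping adjacent rows

count-cong : ∀ {n} {f g : Fin n → Fin n} x y → (∀ a → toℕ a < x → f a ≡ g a) → count f x y ≡ count g x y
count-cong zero    y e = refl
count-cong (suc x) y e = cong₂ _+_ (count-cong x y (λ a p → e a (ℕP.m≤n⇒m≤1+n p)))
  (extend-cong-at 0 x (λ a p → cong (λ t → indicator (toℕ t ℕ.<? y)) (e a (s≤s (ℕP.≤-reflexive p)))))

below-≤1 : ∀ {n} (f : Fin n → Fin n) y a → below f y a ≤ 1
below-≤1 f y a = indicator-≤1 (toℕ (f a) ℕ.<? y)

below-anti : ∀ {n} (f : Fin n → Fin n) y {a b} → toℕ (f a) < toℕ (f b) → below f y b ≤ below f y a
below-anti f y {a} {b} fa<fb with toℕ (f b) ℕ.<? y
... | no  fb≮y = ℕP.≤-trans (ℕP.≤-reflexive (indicator-no (toℕ (f b) ℕ.<? y) fb≮y)) z≤n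
... | yes fb<y = ℕP.≤-reflexive (trans (indicator-yes (toℕ (f b) ℕ.<? y) fb<y)
                                       (sym (indicator-yes (toℕ (f a) ℕ.<? y) (ℕP.<-trans fa<fb fb<y))))

module AdjacentSwap {n} (f : Fin n → Fin n) (i : Fin n) (h : suc (toℕ i) < n) where

  private
    I J : ℕ
    I = toℕ i
    J = suc I

    j : Fin n
    j = fromℕ< h

    toℕ-j : toℕ j ≡ J
    toℕ-j = FP.toℕ-fromℕ< h

    i≢j : i ≢ j
    i≢j e = ℕP.<-irrefl (trans (cong toℕ e) toℕ-j) (ℕP.n<1+n I)

    τ : Fin n → Fin n
    τ = PC.transpose i j

    τ-i : τ i ≡ j
    τ-i rewrite dec-true (i F.≟ i) refl = refl

    τ-j : τ j ≡ i
    τ-j rewrite dec-false (j F.≟ i) (i≢j ∘ sym) | dec-true (j F.≟ j) refl = refl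

    τ-other : ∀ {a} → a ≢ i → a ≢ j → τ a ≡ a
    τ-other {a} a≢i a≢j rewrite dec-false (a F.≟ i) a≢i | dec-false (a F.≟ j) a≢j = refl

  swapped : Fin n → Fin n
  swapped = f ∘ τ

  swapped-i : swapped i ≡ f j
  swapped-i = cong f τ-i

  count-swap-below : ∀ x y → x ≤ I → count swapped x y ≡ count f x y
  count-swap-below x y x≤I = count-cong x y (λ a a<x → cong f (τ-other
    (λ { refl → ℕP.<-irrefl refl (ℕP.<-≤-trans a<x x≤I) })
    (λ { refl → ℕP.<-irrefl toℕ-j (ℕP.<-≤-trans a<x (ℕP.m≤n⇒m≤1+n x≤I)) })))

  count-swap-row : ∀ y → count swapped J y ≡ count f I y + below f y j
  count-swap-row y = begin
    count swapped J y                      ≡⟨ count-row swapped i y ⟩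
    count swapped I y + below swapped y i  ≡⟨ cong₂ _+_ (count-swap-below I y ℕP.≤-refl) (cong (below f y) τ-i) ⟩
    count f I y + below f y j              ∎
    where open ≡-Reasoning

  count-swap-above : ∀ x y → J < x → count swapped x y ≡ count f x y
  count-swap-above (suc x) y (s≤s J≤x) with ℕP.m≤n⇒m<n∨m≡n J≤x
  ... | inj₂ refl = begin
      count swapped J y + extend 0 (below swapped y) J ≡⟨ cong₂ _+_ (count-swap-row y) (extend-fromℕ< 0 (below swapped y) h) ⟩
      count f I y + below f y j + below swapped y j     ≡⟨ cong (λ t → count f I y + below f y j + below f y t) τ-j ⟩
      count f I y + below f y j + below f y i           ≡⟨ ℕ+.xy∙z≈xz∙y (count f I y) _ _ ⟩
      count f I y + below f y i + below f y j           ≡⟨ cong₂ _+_ (sym (count-row f i y)) (sym (extend-fromℕ< 0 (below f y) h)) ⟩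
      count f J y + extend 0 (below f y) J              ∎
    where open ≡-Reasoning
  ... | inj₁ J<x = cong₂ _+_ (count-swap-above x y J<x) (extend-cong-at 0 x (λ a a≡x →
      cong (below f y)
        (τ-other {a} (λ { refl → ℕP.<-irrefl a≡x (ℕP.<-trans (ℕP.n<1+n I) J<x) })
                     (λ { refl → ℕP.<-irrefl (trans (sym toℕ-j) a≡x) J<x }))))

  count-swap-off : ∀ x y → x ≢ J → count swapped x y ≡ count f x y
  count-swap-off x y x≢J with x ℕ.≤? I
  ... | yes x≤I = count-swap-below x y x≤I
  ... | no  x≰I = count-swap-above x y (ℕP.≤∧≢⇒< (ℕP.≰⇒> x≰I) (x≢J ∘ sym))

module _ {n} {A : Mat n} (asm : IsASM n A) (i : Fin n) (h : suc (toℕ i) < n) where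
  open ProjectionOfASM asm i h using (rankA; π; π≡A⇒row)

  permDescent⇒π≢A : ∀ (w : Permutation′ n) → InPerm A w → PermDescent w i h → ¬ (π ≡ₘ A)
  permDescent⇒π≢A w (A≤w , w-minimal) descent π≡A = 1≢0 (trans (sym hit) (trans (sym (u≡w i (f i))) miss))
    where
    I J : ℕ
    I = toℕ i
    J = suc I

    j : Fin n
    j = fromℕ< h

    f : Fin n → Fin n
    f = w ⟨$⟩ʳ_

    open AdjacentSwap f i h

    s : ℕ → ℕ → ℕ
    s = Rank.s rankA

    cornersA : NatCorners n A
    cornersA = rank⇒natCorners rankA

    I≤n : I ≤ n
    I≤n = ℕP.<⇒≤ (ℕP.<-trans (ℕP.n<1+n I) h)

    count-J+1 : ∀ y → count f (suc J) y ≡ count f J y + below f y j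
    count-J+1 y = cong (_+_ (count f J y)) (extend-fromℕ< 0 (below f y) h)

    w-below-s : ∀ x y → x ≤ n → y ≤ n → count f x y ≤ s x y
    w-below-s = CompareCorners.≤ₛ⇒≥ cornersA (funMat-corners f) A≤w

    -- Only here is π = A used: it pins row J of s to the largest value the steps allow.
    swapped-below-s : ∀ x y → x ≤ n → y ≤ n → count swapped x y ≤ s x y
    swapped-below-s x y p q with x ℕ.≟ J
    ... | no  x≢J  = ℕP.≤-trans (ℕP.≤-reflexive (count-swap-off x y x≢J)) (w-below-s x y p q)
    ... | yes refl = begin
        count swapped J y          ≡⟨ count-swap-row y ⟩
        count f I y + below f y j  ≤⟨ ℕP.⊓-glb toRowI toRowJ+1 ⟩
        suc (s I y) ⊓ s (suc J) y  ≡⟨ sym (π≡A⇒row π≡A y q) ⟩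
        s J y                      ∎
      where
      open ℕP.≤-Reasoning
      toRowI : count f I y + below f y j ≤ suc (s I y)
      toRowI = ℕP.≤-trans (ℕP.+-mono-≤ (w-below-s I y I≤n q) (below-≤1 f y j)) (ℕP.≤-reflexive (ℕP.+-comm (s I y) 1))
      toRowJ+1 : count f I y + below f y j ≤ s (suc J) y
      toRowJ+1 = ℕP.≤-trans (ℕP.+-monoˡ-≤ (below f y j) (ℕP.≤-trans (ℕP.m≤m+n (count f I y) (below f y i))
                                                                   (ℕP.≤-reflexive (sym (count-row f i y)))))
                   (ℕP.≤-trans (ℕP.≤-reflexive (sym (count-J+1 y))) (w-below-s (suc J) y h q))

    w-below-swapped : ∀ x y → x ≤ n → y ≤ n → count f x y ≤ count swapped x y
    w-below-swapped x y p q with x ℕ.≟ J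
    ... | no  x≢J  = ℕP.≤-reflexive (sym (count-swap-off x y x≢J))
    ... | yes refl = ℕP.≤-trans (ℕP.≤-reflexive (count-row f i y))
                       (ℕP.≤-trans (ℕP.+-monoʳ-≤ (count f I y) (below-anti f y descent)) (ℕP.≤-reflexive (sym (count-swap-row y))))

    u : Permutation′ n
    u = transpose i j ∘ₚ w

    u≡w : permMat u ≡ₘ permMat w
    u≡w = w-minimal u (CompareCorners.≥⇒≤ₛ cornersA (funMat-corners swapped) swapped-below-s)
                      (CompareCorners.≥⇒≤ₛ (funMat-corners swapped) (funMat-corners f) w-below-swapped)

    hit : permMat w i (f i) ≡ 1ℤ
    hit = unit-hit (f i) (f i) refl

    miss : permMat u i (f i) ≡ 0ℤ
    miss = unit-miss (swapped i) (f i) (λ e → ℕP.<-irrefl (cong toℕ (trans (sym swapped-i) e)) descent)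

    1≢0 : 1ℤ ≢ 0ℤ
    1≢0 ()

-- The greedy permutation

-- K ∸ (M ∸ y) counts the k < K with M ∸ suc k < y.
countDown-suc : ∀ K M y → K < M → suc K ∸ (M ∸ y) ≡ (K ∸ (M ∸ y)) + indicator (M ∸ suc K ℕ.<? y)
countDown-suc K M y K<M with (M ∸ y) ℕ.≤? K
countDown-suc K M zero    K<M | yes M≤K = ⊥-elim (ℕP.<⇒≱ K<M M≤K)
countDown-suc K M (suc y) K<M | yes M∸y≤K = trans (ℕP.+-∸-assoc 1 M∸y≤K)
    (trans (ℕP.+-comm 1 _) (cong (_+_ (K ∸ (M ∸ suc y))) (sym (indicator-yes (M ∸ suc K ℕ.<? suc y) lt))))
  where
  M≤ : M ≤ suc y + K
  M≤ = ℕP.≤-trans (ℕP.m≤n+m∸n M (suc y)) (ℕP.+-monoʳ-≤ (suc y) M∸y≤K)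
  lt : M ∸ suc K < suc y
  lt = ℕP.m<n+o⇒m∸n<o M (suc K) (ℕP.≤-trans (s≤s M≤)
         (ℕP.≤-reflexive (cong suc (trans (cong suc (ℕP.+-comm y K)) (sym (ℕP.+-suc K y))))))
countDown-suc K M y K<M | no M∸y≰K with y ℕ.≤? M
... | no  y≰M = ⊥-elim (M∸y≰K (ℕP.≤-trans (ℕP.≤-reflexive (ℕP.m≤n⇒m∸n≡0 (ℕP.<⇒≤ (ℕP.≰⇒> y≰M)))) z≤n))
... | yes y≤M = trans (ℕP.m≤n⇒m∸n≡0 K<M∸y)
    (sym (cong₂ _+_ (ℕP.m≤n⇒m∸n≡0 (ℕP.<⇒≤ K<M∸y)) (indicator-no (M ∸ suc K ℕ.<? y) (ℕP.≤⇒≯ y≤))))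
  where
  K<M∸y : suc K ≤ M ∸ y
  K<M∸y = ℕP.≰⇒> M∸y≰K
  y≤ : y ≤ M ∸ suc K
  y≤ = ℕP.m+n≤o⇒m≤o∸n y (ℕP.≤-trans (ℕP.≤-reflexive (ℕP.+-comm y (suc K))) (ℕP.m≤o∸n⇒m+n≤o (suc K) y≤M K<M∸y))

+≤+⇒∸≤∸ : ∀ a b d e → a + d ≤ b + e → a ∸ b ≤ e ∸ d
+≤+⇒∸≤∸ a b d e p with b ℕ.≤? a
... | no  b≰a = ℕP.≤-trans (ℕP.≤-reflexive (ℕP.m≤n⇒m∸n≡0 (ℕP.<⇒≤ (ℕP.≰⇒> b≰a)))) z≤n
... | yes b≤a = ℕP.m+n≤o⇒m≤o∸n (a ∸ b) (ℕP.+-cancelˡ-≤ b _ _ (ℕP.≤-trans (ℕP.≤-reflexive eq) p))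
  where
  eq : b + (a ∸ b + d) ≡ a + d
  eq = trans (sym (ℕP.+-assoc b (a ∸ b) d)) (cong (_+ d) (ℕP.m+[n∸m]≡n b≤a))

+≤+⇒∸∸≤ : ∀ K y c t → y ≤ c → K + y ≤ t + c → K ∸ (c ∸ y) ≤ t
+≤+⇒∸∸≤ K y c t y≤c p = ℕP.m≤n+o⇒m∸n≤o K (c ∸ y) (ℕP.+-cancelʳ-≤ y K _ (ℕP.≤-trans p (ℕP.≤-reflexive eq)))
  where
  eq : t + c ≡ (c ∸ y) + t + y
  eq = trans (cong (_+_ t) (sym (ℕP.m∸n+n≡m y≤c))) (ℕ+.x∙yz≈yx∙z t (c ∸ y) y)

+∸≤ : ∀ K a b t → K ≤ t → K + a ≤ t + b → K + (a ∸ b) ≤ t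
+∸≤ K a b t p q with b ℕ.≤? a
... | no  b≰a =
  ℕP.≤-trans (ℕP.≤-reflexive (trans (cong (_+_ K) (ℕP.m≤n⇒m∸n≡0 (ℕP.<⇒≤ (ℕP.≰⇒> b≰a)))) (ℕP.+-identityʳ K))) p
... | yes b≤a = ℕP.+-cancelʳ-≤ b _ _ (ℕP.≤-trans (ℕP.≤-reflexive eq) q)
  where
  eq : K + (a ∸ b) + b ≡ K + a
  eq = trans (ℕP.+-assoc K (a ∸ b) b) (cong (_+_ K) (ℕP.m∸n+n≡m b≤a))

[n∸c]∸[n∸y]≡y∸c : ∀ c y n → c ≤ y → y ≤ n → (n ∸ c) ∸ (n ∸ y) ≡ y ∸ c
[n∸c]∸[n∸y]≡y∸c c y n c≤y y≤n = trans (cong (_∸ (n ∸ y)) split) (ℕP.m+n∸m≡n (n ∸ y) (y ∸ c))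
  where
  split : n ∸ c ≡ (n ∸ y) + (y ∸ c)
  split = trans (cong (_∸ c) (sym (ℕP.m∸n+n≡m y≤n))) (ℕP.+-∸-assoc (n ∸ y) c≤y)

-- Rows x where s rises at column c are sent to columns c - 1, c - 2, … in turn, the other rows to
-- n - 1, n - 2, …; this makes count f agree with s on column c while staying below s.
module GreedyPermutation {n s} (isRank : IsRankFunction n s) (c : ℕ) (c≤n : c ≤ n) where
  open IsRankFunction isRank
  open RankFacts isRank

  rises? : ∀ x → Dec (s (suc x) c ≡ suc (s x c))
  rises? x = s (suc x) c ℕ.≟ suc (s x c)

  column : ℕ → ℕ
  column x = if does (rises? x) then c ∸ suc (s x c) else n ∸ suc (x ∸ s x c)

  column-rise : ∀ x → s (suc x) c ≡ suc (s x c) → column x ≡ c ∸ suc (s x c)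
  column-rise x e rewrite dec-true (rises? x) e = refl

  column-flat : ∀ x → s (suc x) c ≡ s x c → column x ≡ n ∸ suc (x ∸ s x c)
  column-flat x e rewrite dec-false (rises? x) (λ e′ → ℕP.<-irrefl (trans (sym e) e′) (ℕP.n<1+n _)) = refl

  private
    m∸suc<n : ∀ m k → m ≤ n → 0 < n → m ∸ suc k < n
    m∸suc<n zero    k p q = q
    m∸suc<n (suc m) k p q = ℕP.<-≤-trans (s≤s (ℕP.m∸n≤m m k)) p

  column<n : ∀ x → x < n → column x < n
  column<n x p with does (rises? x)
  ... | true  = m∸suc<n c (s x c) c≤n (ℕP.≤-<-trans z≤n p)
  ... | false = m∸suc<n n (x ∸ s x c) ℕP.≤-refl (ℕP.≤-<-trans z≤n p)

  greedy : Fin n → Fin n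
  greedy a = fromℕ< (column<n (toℕ a) (FP.toℕ<n a))

  below-greedy : ∀ x y → x < n → extend 0 (below greedy y) x ≡ indicator (column x ℕ.<? y)
  below-greedy x y p = trans (extend-fromℕ< 0 (below greedy y) p)
    (cong (λ t → indicator (t ℕ.<? y)) (trans (FP.toℕ-fromℕ< _) (cong column (FP.toℕ-fromℕ< p))))

  -- Of the first x rows, s x c go to columns c - 1, …, c - s x c and x - s x c to columns
  -- n - 1, …, n - (x - s x c); count those landing left of y.
  greedyCount : ℕ → ℕ → ℕ
  greedyCount x y = (s x c ∸ (c ∸ y)) + ((x ∸ s x c) ∸ (n ∸ y))

  s≤row : ∀ x → x ≤ n → s x c ≤ x
  s≤row x p = ℕP.≤-trans (monoRight x c n c≤n ℕP.≤-refl p) (ℕP.≤-reflexive (colₙ x p))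

  count-greedy : ∀ x y → x ≤ n → count greedy x y ≡ greedyCount x y
  count-greedy zero y _ rewrite row₀ c | ℕP.0∸n≡0 (c ∸ y) | ℕP.0∸n≡0 (n ∸ y) = refl
  count-greedy (suc x) y p with stepDown x c p c≤n
  ... | inj₂ rise = begin
      count greedy x y + extend 0 (below greedy y) x
    ≡⟨ cong₂ _+_ (count-greedy x y (ℕP.<⇒≤ p))
                 (trans (below-greedy x y p) (cong (λ t → indicator (t ℕ.<? y)) (column-rise x rise))) ⟩
      K ∸ (c ∸ y) + (x ∸ K ∸ (n ∸ y)) + indicator (c ∸ suc K ℕ.<? y)
    ≡⟨ ℕ+.xy∙z≈xz∙y (K ∸ (c ∸ y)) _ _ ⟩
      K ∸ (c ∸ y) + indicator (c ∸ suc K ℕ.<? y) + (x ∸ K ∸ (n ∸ y))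
    ≡⟨ cong (_+ (x ∸ K ∸ (n ∸ y))) (sym (countDown-suc K c y K<c)) ⟩
      suc K ∸ (c ∸ y) + (suc x ∸ suc K ∸ (n ∸ y))
    ≡⟨ cong (λ t → t ∸ (c ∸ y) + (suc x ∸ t ∸ (n ∸ y))) (sym rise) ⟩
      greedyCount (suc x) y ∎
    where
    open ≡-Reasoning
    K : ℕ
    K = s x c
    K<c : K < c
    K<c = ℕP.≤-trans (ℕP.≤-reflexive (sym rise))
            (ℕP.≤-trans (monoDown (suc x) n c p ℕP.≤-refl c≤n) (ℕP.≤-reflexive (rowₙ c c≤n)))
  ... | inj₁ flat = begin
      count greedy x y + extend 0 (below greedy y) x
    ≡⟨ cong₂ _+_ (count-greedy x y (ℕP.<⇒≤ p))
                 (trans (below-greedy x y p) (cong (λ t → indicator (t ℕ.<? y)) (column-flat x flat))) ⟩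
      K ∸ (c ∸ y) + (x ∸ K ∸ (n ∸ y)) + indicator (n ∸ suc (x ∸ K) ℕ.<? y)
    ≡⟨ ℕP.+-assoc (K ∸ (c ∸ y)) _ _ ⟩
      K ∸ (c ∸ y) + (x ∸ K ∸ (n ∸ y) + indicator (n ∸ suc (x ∸ K) ℕ.<? y))
    ≡⟨ cong (_+_ (K ∸ (c ∸ y))) (sym (countDown-suc (x ∸ K) n y (ℕP.≤-<-trans (ℕP.m∸n≤m x K) p))) ⟩
      K ∸ (c ∸ y) + (suc (x ∸ K) ∸ (n ∸ y))
    ≡⟨ cong (λ t → K ∸ (c ∸ y) + (t ∸ (n ∸ y))) (sym (ℕP.+-∸-assoc 1 (s≤row x (ℕP.<⇒≤ p)))) ⟩
      K ∸ (c ∸ y) + (suc x ∸ K ∸ (n ∸ y))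
    ≡⟨ cong (λ t → t ∸ (c ∸ y) + (suc x ∸ t ∸ (n ∸ y))) (sym flat) ⟩
      greedyCount (suc x) y ∎
    where
    open ≡-Reasoning
    K : ℕ
    K = s x c

  private
    flatRows≤ : ∀ x → x ≤ n → x ∸ s x c ≤ n ∸ c
    flatRows≤ x p = +≤+⇒∸≤∸ x (s x c) c n
      (ℕP.≤-trans (ℕP.≤-reflexive (cong (_+ c) (sym (colₙ x p)))) (proj₂ (lipschitzRight x p c n c≤n ℕP.≤-refl)))

  greedy-below-s : ∀ x y → x ≤ n → y ≤ n → count greedy x y ≤ s x y
  greedy-below-s x y p q rewrite count-greedy x y p with y ℕ.≤? c
  ... | yes y≤c = ℕP.≤-trans (ℕP.≤-reflexive (trans (cong (_+_ (s x c ∸ (c ∸ y))) flat-part) (ℕP.+-identityʳ _)))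
                    (+≤+⇒∸∸≤ (s x c) y c (s x y) y≤c (proj₂ (lipschitzRight x p y c y≤c c≤n)))
    where
    flat-part : (x ∸ s x c) ∸ (n ∸ y) ≡ 0
    flat-part = ℕP.m≤n⇒m∸n≡0 (ℕP.≤-trans (flatRows≤ x p) (ℕP.∸-monoʳ-≤ n y≤c))
  ... | no  y≰c = ℕP.≤-trans (ℕP.≤-reflexive (cong (λ t → (s x c ∸ t) + ((x ∸ s x c) ∸ (n ∸ y))) (ℕP.m≤n⇒m∸n≡0 c≤y)))
                    (+∸≤ (s x c) (x ∸ s x c) (n ∸ y) (s x y) (monoRight x c y c≤y q p) bound)
    where
    c≤y : c ≤ y
    c≤y = ℕP.<⇒≤ (ℕP.≰⇒> y≰c)
    bound′ : x + y ≤ s x y + (n ∸ y) + y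
    bound′ = ℕP.≤-trans (ℕP.≤-reflexive (cong (_+ y) (sym (colₙ x p))))
               (ℕP.≤-trans (proj₂ (lipschitzRight x p y n q ℕP.≤-refl))
                 (ℕP.≤-reflexive (trans (cong (_+_ (s x y)) (sym (ℕP.m∸n+n≡m q))) (sym (ℕP.+-assoc (s x y) (n ∸ y) y)))))
    bound : s x c + (x ∸ s x c) ≤ s x y + (n ∸ y)
    bound = ℕP.≤-trans (ℕP.≤-reflexive (ℕP.m+[n∸m]≡n (s≤row x p))) (ℕP.+-cancelʳ-≤ y x _ bound′)

  count-greedy-col : ∀ x → x ≤ n → count greedy x c ≡ s x c
  count-greedy-col x p rewrite count-greedy x c p | ℕP.n∸n≡0 c | ℕP.m≤n⇒m∸n≡0 (flatRows≤ x p) = ℕP.+-identityʳ _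

  count-greedy-lastRow : ∀ y → y ≤ n → count greedy n y ≡ y
  count-greedy-lastRow y q rewrite count-greedy n y ℕP.≤-refl | rowₙ c c≤n with y ℕ.≤? c
  ... | yes y≤c rewrite ℕP.m∸[m∸n]≡n y≤c | ℕP.m≤n⇒m∸n≡0 (ℕP.∸-monoʳ-≤ n y≤c) = ℕP.+-identityʳ y
  ... | no  y≰c
    rewrite ℕP.m≤n⇒m∸n≡0 (ℕP.<⇒≤ (ℕP.≰⇒> y≰c)) | [n∸c]∸[n∸y]≡y∸c c y n (ℕP.<⇒≤ (ℕP.≰⇒> y≰c)) q =
    ℕP.m+[n∸m]≡n (ℕP.<⇒≤ (ℕP.≰⇒> y≰c))

hits : ∀ {n} → (Fin n → Fin n) → ℕ → Fin n → ℕ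
hits f v a = indicator (toℕ (f a) ℕ.≟ v)

countEq : ∀ {n} → (Fin n → Fin n) → ℕ → ℕ → ℕ
countEq f zero    v = 0
countEq f (suc x) v = countEq f x v + extend 0 (hits f v) x

extend-+ : ∀ {n} (g h : Fin n → ℕ) x → extend 0 (λ a → g a + h a) x ≡ extend 0 g x + extend 0 h x
extend-+ {zero}  g h x       = refl
extend-+ {suc n} g h zero    = refl
extend-+ {suc n} g h (suc x) = extend-+ (g ∘ suc) (h ∘ suc) x

indicator-<-suc : ∀ t v → indicator (t ℕ.<? suc v) ≡ indicator (t ℕ.<? v) + indicator (t ℕ.≟ v)
indicator-<-suc t v with ℕP.<-cmp t v
... | tri< t<v t≢v _
  rewrite indicator-yes (t ℕ.<? suc v) (ℕP.m≤n⇒m≤1+n t<v) | indicator-yes (t ℕ.<? v) t<v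
        | indicator-no (t ℕ.≟ v) t≢v = refl
... | tri≈ t≮v t≡v _
  rewrite indicator-yes (t ℕ.<? suc v) (s≤s (ℕP.≤-reflexive t≡v)) | indicator-no (t ℕ.<? v) t≮v
        | indicator-yes (t ℕ.≟ v) t≡v = refl
... | tri> t≮v t≢v v<t
  rewrite indicator-no (t ℕ.<? suc v) (ℕP.<⇒≱ v<t ∘ ℕP.≤-pred) | indicator-no (t ℕ.<? v) t≮v
        | indicator-no (t ℕ.≟ v) t≢v = refl

count-suc : ∀ {n} (f : Fin n → Fin n) x v → count f x (suc v) ≡ count f x v + countEq f x v
count-suc f zero    v = refl
count-suc f (suc x) v rewrite count-suc f x v =
  trans (cong (_+_ (count f x v + countEq f x v))
          (trans (extend-cong 0 (λ a → indicator-<-suc (toℕ (f a)) v) x) (extend-+ (below f v) (hits f v) x)))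
        (ℕ+.interchange (count f x v) (countEq f x v) (extend 0 (below f v) x) (extend 0 (hits f v) x))

countEq-two : ∀ {n} (f : Fin n → Fin n) {a b : Fin n} v → a ≢ b → toℕ (f a) ≡ v → toℕ (f b) ≡ v →
  ∀ x → indicator (toℕ a ℕ.<? x) + indicator (toℕ b ℕ.<? x) ≤ countEq f x v
countEq-two f {a} {b} v a≢b fa fb zero
  rewrite indicator-no (toℕ a ℕ.<? 0) (λ ()) | indicator-no (toℕ b ℕ.<? 0) (λ ()) = z≤n
countEq-two f {a} {b} v a≢b fa fb (suc x) =
  ℕP.≤-trans (ℕP.≤-reflexive (trans (cong₂ _+_ (indicator-<-suc (toℕ a) x) (indicator-<-suc (toℕ b) x))
                                    (ℕ+.interchange (indicator (toℕ a ℕ.<? x)) (indicator (toℕ a ℕ.≟ x))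
                                                 (indicator (toℕ b ℕ.<? x)) (indicator (toℕ b ℕ.≟ x)))))
             (ℕP.+-mono-≤ (countEq-two f v a≢b fa fb x) (atRow (toℕ a ℕ.≟ x) (toℕ b ℕ.≟ x)))
  where
  hit : ∀ {c} → toℕ c ≡ x → toℕ (f c) ≡ v → extend 0 (hits f v) x ≡ 1
  hit {c} c≡x fc = trans (cong (extend 0 (hits f v)) (sym c≡x))
                         (trans (extend-toℕ 0 (hits f v) c) (indicator-yes (toℕ (f c) ℕ.≟ v) fc))
  atRow : (da : Dec (toℕ a ≡ x)) (db : Dec (toℕ b ≡ x)) → indicator da + indicator db ≤ extend 0 (hits f v) x
  atRow (yes a≡x) (yes b≡x) = ⊥-elim (a≢b (FP.toℕ-injective (trans a≡x (sym b≡x))))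
  atRow (yes a≡x) (no _)    = ℕP.≤-reflexive (sym (hit a≡x fa))
  atRow (no _)    (yes b≡x) = ℕP.≤-reflexive (sym (hit b≡x fb))
  atRow (no _)    (no _)    = z≤n

-- f hits every value exactly once: count f n (v + 1) - count f n v = 1.
count-lastRow⇒injective : ∀ {n} (f : Fin n → Fin n) → (∀ y → y ≤ n → count f n y ≡ y) → Injective _≡_ _≡_ f
count-lastRow⇒injective {n} f last {a} {b} fa≡fb with a F.≟ b
... | yes a≡b = a≡b
... | no  a≢b = ⊥-elim (ℕP.<-irrefl refl (ℕP.≤-trans twice (ℕP.≤-reflexive once)))
  where
  v : ℕ
  v = toℕ (f a)
  v<n : v < n
  v<n = FP.toℕ<n (f a)
  once : countEq f n v ≡ 1
  once = ℕP.+-cancelˡ-≡ v _ 1 (trans (cong (_+ countEq f n v) (sym (last v (ℕP.<⇒≤ v<n))))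
           (trans (sym (count-suc f n v)) (trans (last (suc v) v<n) (ℕP.+-comm 1 v))))
  twice : 2 ≤ countEq f n v
  twice = ℕP.≤-trans (ℕP.≤-reflexive (cong₂ _+_ (sym (indicator-yes (toℕ a ℕ.<? n) (FP.toℕ<n a)))
                                                (sym (indicator-yes (toℕ b ℕ.<? n) (FP.toℕ<n b)))))
                     (countEq-two f v a≢b refl (cong toℕ (sym fa≡fb)) n)

-- Minimal permutations above an ASM

ΣFinℕ : ∀ n → (Fin n → ℕ) → ℕ
ΣFinℕ zero    g = 0
ΣFinℕ (suc n) g = g zero + ΣFinℕ n (g ∘ suc)

ΣFinℕ-mono : ∀ n {g h : Fin n → ℕ} → (∀ k → g k ≤ h k) → ΣFinℕ n g ≤ ΣFinℕ n h
ΣFinℕ-mono zero    le = z≤n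
ΣFinℕ-mono (suc n) le = ℕP.+-mono-≤ (le zero) (ΣFinℕ-mono n (le ∘ suc))

ΣFinℕ-≤-tight : ∀ n {g h : Fin n → ℕ} → (∀ k → g k ≤ h k) → ΣFinℕ n h ≤ ΣFinℕ n g → ∀ k → g k ≡ h k
ΣFinℕ-≤-tight (suc n) {g} {h} le ge k with ℕP.m≤n⇒m<n∨m≡n (le zero)
... | inj₁ lt = ⊥-elim (ℕP.<⇒≱ (ℕP.+-mono-<-≤ lt (ΣFinℕ-mono n (le ∘ suc))) ge)
ΣFinℕ-≤-tight (suc n)         le ge zero    | inj₂ e = e
ΣFinℕ-≤-tight (suc n) {g} {h} le ge (suc k) | inj₂ e = ΣFinℕ-≤-tight n (le ∘ suc)
  (ℕP.+-cancelˡ-≤ (g zero) _ _ (ℕP.≤-trans (ℕP.≤-reflexive (cong (_+ ΣFinℕ n (h ∘ suc)) e)) ge)) k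

any-function? : ∀ m k (Q : (Fin m → Fin k) → Set) → (∀ g → Dec (Q g)) →
  (∀ {g g′} → (∀ a → g a ≡ g′ a) → Q g → Q g′) → Dec (Σ (Fin m → Fin k) Q)
any-function? zero    k Q Q? resp with Q? (λ ())
... | yes q = yes (_ , q)
... | no ¬q = no (λ { (g , q) → ¬q (resp (λ ()) q) })
any-function? (suc m) k Q Q? resp with FP.any? (λ x → any-function? m k (Q ∘ (x V.∷_)) (Q? ∘ (x V.∷_))
                                                      (λ e → resp (λ { zero → refl ; (suc j) → e j })))
... | yes (x , g , q) = yes (_ , q)
... | no ¬ex = no (λ { (g , q) → ¬ex (g zero , (g ∘ suc) , resp (λ { zero → refl ; (suc j) → refl }) q) })

rk-cong : ∀ {n} {M M′ : Mat n} → M ≡ₘ M′ → ∀ a b → rk M a b ≡ rk M′ a b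
rk-cong {M = M} {M′} e a b =
  trans (rk≡corner M a b) (trans (corner-cong e (suc (toℕ a)) (suc (toℕ b))) (sym (rk≡corner M′ a b)))

funMat-cong : ∀ {n} {g g′ : Fin n → Fin n} → (∀ a → g a ≡ g′ a) → funMat g ≡ₘ funMat g′
funMat-cong e a b rewrite e a = refl

_≤ₛ?_ : ∀ {n} (M M′ : Mat n) → Dec (M ≤ₛ M′)
M ≤ₛ? M′ = FP.all? (λ a → FP.all? (λ b → rk M′ a b ℤP.≤? rk M a b))

_≡ₘ?_ : ∀ {n} (M M′ : Mat n) → Dec (M ≡ₘ M′)
M ≡ₘ? M′ = FP.all? (λ a → FP.all? (λ b → M a b ℤP.≟ M′ a b))

injective? : ∀ {n} (g : Fin n → Fin n) → Dec (Injective _≡_ _≡_ g)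
injective? g = map′ (λ inj {a} {b} → inj a b) (λ inj a b → inj {a} {b})
  (FP.all? (λ a → FP.all? (λ b → (g a F.≟ g b) →-dec (a F.≟ b))))

≤ₛ-trans : ∀ {n} {M M′ M″ : Mat n} → M ≤ₛ M′ → M′ ≤ₛ M″ → M ≤ₛ M″
≤ₛ-trans p q a b = ℤP.≤-trans (q a b) (p a b)

≤ₛ-refl : ∀ {n} {M : Mat n} → M ≤ₛ M
≤ₛ-refl a b = ℤP.≤-refl

module MinimalPermutations {n} {A : Mat n} (cornersA : NatCorners n A) where
  open NatCorners cornersA using (s)

  gap : (Fin n → Fin n) → Fin n → Fin n → ℕ
  gap g a b = s (suc (toℕ a)) (suc (toℕ b)) ∸ count g (suc (toℕ a)) (suc (toℕ b))

  defect : (Fin n → Fin n) → ℕ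
  defect g = ΣFinℕ n (λ a → ΣFinℕ n (gap g a))

  defect-decreasing : ∀ {g h} → A ≤ₛ funMat g → funMat g ≤ₛ funMat h → ¬ (funMat g ≡ₘ funMat h) → defect g < defect h
  defect-decreasing {g} {h} A≤g g≤h g≢h with defect g ℕ.<? defect h
  ... | yes lt = lt
  ... | no  ≮  = ⊥-elim (g≢h (CompareCorners.≡⇒≡ₘ (funMat-corners g) (funMat-corners h) same))
    where
    g≤s : ∀ x y → x ≤ n → y ≤ n → count g x y ≤ s x y
    g≤s = CompareCorners.≤ₛ⇒≥ cornersA (funMat-corners g) A≤g
    h≤g : ∀ x y → x ≤ n → y ≤ n → count h x y ≤ count g x y
    h≤g = CompareCorners.≤ₛ⇒≥ (funMat-corners g) (funMat-corners h) g≤h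
    gap≤ : ∀ a b → gap g a b ≤ gap h a b
    gap≤ a b = ℕP.∸-monoʳ-≤ _ (h≤g _ _ (FP.toℕ<n a) (FP.toℕ<n b))
    gap≡ : ∀ a b → gap g a b ≡ gap h a b
    gap≡ a = ΣFinℕ-≤-tight n (gap≤ a)
      (ℕP.≤-reflexive (sym (ΣFinℕ-≤-tight n (λ a → ΣFinℕ-mono n (gap≤ a)) (ℕP.≮⇒≥ ≮) a)))
    same : ∀ x y → x ≤ n → y ≤ n → count g x y ≡ count h x y
    same x y p q with gridCases x y p q
    ... | inj₁ (inj₁ refl) = refl
    ... | inj₁ (inj₂ refl) = trans (count-col₀ g x) (sym (count-col₀ h x))
    ... | inj₂ (a , b , refl , refl) = trans (sym (ℕP.m∸[m∸n]≡n (g≤s _ _ p q)))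
          (trans (cong (s x y ∸_) (gap≡ a b)) (ℕP.m∸[m∸n]≡n (ℕP.≤-trans (h≤g _ _ p q) (g≤s _ _ p q))))

  StrictlyBelow : Mat n → (Fin n → Fin n) → Set
  StrictlyBelow W g = Injective _≡_ _≡_ g × A ≤ₛ funMat g × funMat g ≤ₛ W × ¬ (funMat g ≡ₘ W)

  strictlyBelow? : ∀ W g → Dec (StrictlyBelow W g)
  strictlyBelow? W g = injective? g ×-dec (A ≤ₛ? funMat g) ×-dec (funMat g ≤ₛ? W) ×-dec ¬? (funMat g ≡ₘ? W)

  strictlyBelow-resp : ∀ W {g g′} → (∀ a → g a ≡ g′ a) → StrictlyBelow W g → StrictlyBelow W g′
  strictlyBelow-resp W {g} {g′} e (inj , A≤g , g≤W , g≢W) =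
    (λ p → inj (trans (e _) (trans p (sym (e _))))) ,
    (λ a b → subst (ℤ._≤ rk A a b) (rk-cong (funMat-cong e) a b) (A≤g a b)) ,
    (λ a b → subst (rk W a b ℤ.≤_) (rk-cong (funMat-cong e) a b) (g≤W a b)) ,
    (λ g′≡W → g≢W (λ a b → trans (funMat-cong e a b) (g′≡W a b)))

  -- Descent on the defect, with k as fuel.
  minimal-below : ∀ k (w : Permutation′ n) → defect (w ⟨$⟩ʳ_) < k → A ≤ₛ permMat w →
    Σ (Permutation′ n) λ m → InPerm A m × permMat m ≤ₛ permMat w
  minimal-below (suc k) w lt A≤w
    with any-function? n n (StrictlyBelow (permMat w)) (strictlyBelow? (permMat w)) (strictlyBelow-resp (permMat w))
  ... | yes (g , inj , A≤g , g≤w , g≢w)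
    with minimal-below k (proj₁ (injective⇒permutation g inj))
                         (ℕP.≤-trans (defect-decreasing A≤g g≤w g≢w) (ℕP.≤-pred lt)) A≤g
  ...   | m , m∈Perm , m≤g = m , m∈Perm , ≤ₛ-trans m≤g g≤w
  minimal-below (suc k) w lt A≤w | no none = w , (A≤w , minimal) , ≤ₛ-refl
    where
    minimal : ∀ u → A ≤ₛ permMat u → permMat u ≤ₛ permMat w → permMat u ≡ₘ permMat w
    minimal u A≤u u≤w with permMat u ≡ₘ? permMat w
    ... | yes u≡w = u≡w
    ... | no  u≢w = ⊥-elim (none ((u ⟨$⟩ʳ_) , permutation-injective u , A≤u , u≤w , u≢w))

  InPerm-below : ∀ (w : Permutation′ n) → A ≤ₛ permMat w → Σ (Permutation′ n) λ m → InPerm A m × permMat m ≤ₛ permMat w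
  InPerm-below w = minimal-below (suc (defect (w ⟨$⟩ʳ_))) w (ℕP.n<1+n _)

flat-rise⇒descent : ∀ {n} (f : Fin n → Fin n) (i : Fin n) (h : suc (toℕ i) < n) c →
  count f (suc (toℕ i)) c ≡ count f (toℕ i) c → count f (suc (suc (toℕ i))) c ≡ suc (count f (suc (toℕ i)) c) →
  toℕ (f (fromℕ< h)) < toℕ (f i)
flat-rise⇒descent f i h c flat rise = ℕP.<-≤-trans fj<c (ℕP.≮⇒≥ fi≮c)
  where
  fi≮c : ¬ toℕ (f i) < c
  fi≮c = indicator≡0 (toℕ (f i) ℕ.<? c)
    (ℕP.+-cancelˡ-≡ (count f (toℕ i) c) _ 0 (trans (sym (count-row f i c)) (trans flat (sym (ℕP.+-identityʳ _)))))
  fj<c : toℕ (f (fromℕ< h)) < c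
  fj<c = indicator≡1 (toℕ (f (fromℕ< h)) ℕ.<? c)
    (ℕP.+-cancelˡ-≡ (count f (suc (toℕ i)) c) _ 1
      (trans (cong (_+_ (count f (suc (toℕ i)) c)) (sym (extend-fromℕ< 0 (below f c) h))) (trans rise (ℕP.+-comm 1 _))))

module _ {n} {A : Mat n} (asm : IsASM n A) (i : Fin n) (h : suc (toℕ i) < n) where
  open ProjectionOfASM asm i h using (rankA)
  open Rank rankA using (s; isRank)

  descentColumn⇒permDescent : DescentColumn n s (toℕ i) → Σ (Permutation′ n) λ w → InPerm A w × PermDescent w i h
  descentColumn⇒permDescent (c , c≤n , flat , rise) = m , m∈Perm , descent
    where
    open GreedyPermutation isRank c c≤n

    cornersA : NatCorners n A
    cornersA = rank⇒natCorners rankA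

    w₀ : Permutation′ n
    w₀ = proj₁ (injective⇒permutation greedy (count-lastRow⇒injective greedy count-greedy-lastRow))

    minimal : Σ (Permutation′ n) λ m → InPerm A m × permMat m ≤ₛ permMat w₀
    minimal = MinimalPermutations.InPerm-below cornersA w₀
                (CompareCorners.≥⇒≤ₛ cornersA (funMat-corners greedy) greedy-below-s)

    m : Permutation′ n
    m = proj₁ minimal

    m∈Perm : InPerm A m
    m∈Perm = proj₁ (proj₂ minimal)

    f : Fin n → Fin n
    f = m ⟨$⟩ʳ_

    -- m is squeezed between A and the greedy permutation, which both have corner sums s on column c.
    count-col : ∀ x → x ≤ n → count f x c ≡ s x c
    count-col x p = ℕP.≤-antisym (CompareCorners.≤ₛ⇒≥ cornersA (funMat-corners f) (proj₁ m∈Perm) x c p c≤n)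
      (ℕP.≤-trans (ℕP.≤-reflexive (sym (count-greedy-col x p)))
        (CompareCorners.≤ₛ⇒≥ (funMat-corners f) (funMat-corners greedy) (proj₂ (proj₂ minimal)) x c p c≤n))

    I≤n : toℕ i ≤ n
    I≤n = ℕP.<⇒≤ (ℕP.<-trans (ℕP.n<1+n (toℕ i)) h)

    descent : PermDescent m i h
    descent = flat-rise⇒descent f i h c
      (trans (count-col _ (ℕP.<⇒≤ h)) (trans (sym flat) (sym (count-col _ I≤n))))
      (trans (count-col _ h) (trans rise (cong suc (sym (count-col _ (ℕP.<⇒≤ h))))))

corollary3p15 : (n : ℕ) (A : Mat n) → IsASM n A →
    (i : Fin n) (h : suc (toℕ i) < n) →
    ASMDescent A i ⇔ Σ (Permutation′ n) (λ w → InPerm A w × PermDescent w i h)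
corollary3p15 n A asm i h = mk⇔
  (λ d → descentColumn⇒permDescent asm i h (asmDescent⇒descentColumn d))
  (λ (w , w∈Perm , descent) → π , π-isPi , permDescent⇒π≢A asm i h w w∈Perm descent)
  where open ProjectionOfASM asm i h
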